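{- Let $p$ be any prime, $m$ a positive integer, $q=p^m$, $s>1$ a positive integer, and $a\in\mu_{q^2+q+1}=\{x\in\mathbb{F}_{q^3}: x^{q^2+q+1}=1\}$. Then $$f_6(X)=2X^{q^2}+(a+a^{q+q^2})X^q+\left(a^{1+q^2}+a^{q}\right)X+\mathrm{Tr}_m^{3m}(X)^s\in\mathbb{F}_{q^3}[X]$$ is a permutation polynomial of $\mathbb{F}_{q^3}$ if and only if $a\neq 1$ and $\gcd(s,q-1)=1$.
   Context: $\mathrm{Tr}_m^{3m}(X)=X+X^q+X^{q^2}$ is the relative trace from $\mathbb{F}_{q^3}$ to $\mathbb{F}_q$. A polynomial $f\in\mathbb{F}_{q^3}[X]$ is a permutation polynomial of $\mathbb{F}_{q^3}$ if $c\mapsto f(c)$ is a bijection of $\mathbb{F}_{q^3}$. -}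

module Defs where

open import Level using (Level; _⊔_)
open import Algebra.Bundles using (CommutativeRing; Semiring)
import Algebra.Definitions.RawSemiring as RawSemiringDefs
open import Data.Nat using (ℕ) renaming (_+_ to _+ℕ_; _*_ to _*ℕ_)
open import Data.Fin using (Fin)
open import Data.Product using (∃; _×_)
open import Relation.Nullary using (¬_)
open import Relation.Binary.PropositionalEquality using (_≡_)
open import Function.Definitions using (Injective; Surjective)

record IsFiniteField {c ℓ : Level} (R : CommutativeRing c ℓ) (N : ℕ) : Set (c ⊔ ℓ) where
  open CommutativeRing R
  field
    1≉0             : ¬ (1# ≈ 0#)
    inverse         : ∀ x → ¬ (x ≈ 0#) → ∃ λ y → x * y ≈ 1#
    enum            : Fin N → Carrier
    enum-injective  : ∀ i j → enum i ≈ enum j → i ≡ j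
    enum-surjective : ∀ x → ∃ λ i → enum i ≈ x

module _ {c ℓ : Level} (R : CommutativeRing c ℓ) where
  open CommutativeRing R
  open RawSemiringDefs (Semiring.rawSemiring semiring) using (_^_)

  pow : Carrier → ℕ → Carrier
  pow = _^_

  Tr : ℕ → Carrier → Carrier
  Tr q x = x + (x ^ q) + (x ^ (q *ℕ q))

  f6 : (q s : ℕ) → Carrier → Carrier → Carrier
  f6 q s a x =
    ((1# + 1#) * (x ^ (q *ℕ q)))
    + ((a + (a ^ (q +ℕ (q *ℕ q)))) * (x ^ q))
    + (((a ^ (1 +ℕ (q *ℕ q))) + (a ^ q)) * x)
    + ((Tr q x) ^ s)

  IsPermutation : (Carrier → Carrier) → Set (c ⊔ ℓ)
  IsPermutation f = Injective _≈_ _≈_ f × Surjective _≈_ _≈_ f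

module Submission where

-- Write φ x = x ^ q, T for the trace and c = a + a ^ (q + q²) - 2. Then f₆ x = L x + (T x) ^ s where
-- L x = c φ(x) + φ(c) x + 2 T x is additive and 𝔽_q-linear, and T takes values in 𝔽_q. The norm condition
-- a ^ (q² + q + 1) = 1 gives c a = (a - 1)², so c ≠ 0 exactly when a ≠ 1.
-- If a = 1 then f₆ x depends only on T x, and T is not injective. If a ≠ 1, there is a β with T β ≠ 0 and
-- T (β L z) = 0 for all z (β = (c + φ c - φ² c) φ² c in odd characteristic, β = φ² c in characteristic 2).
-- Applying T (β ·) to f₆ x = f₆ y gives (T x) ^ s = (T y) ^ s, so T x = T y when gcd(s, q - 1) = 1, and then
-- L (x - y) = 0 = T (x - y) forces x = y; injectivity suffices as the field is finite. When gcd(s, q - 1) ≠ 1,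
-- pick e with L e = 0 and T e = 1: then f₆ (t e) = t ^ s for t ∈ 𝔽_q, so an s-th root of unity ζ ≠ 1 in 𝔽_q
-- gives f₆ (ζ e) = f₆ e.

open import Level using (_⊔_)
open import Algebra.Bundles using (CommutativeRing; CommutativeMonoid)
import Algebra.Properties.CommutativeMonoid.Sum as MonoidSum
import Algebra.Properties.CommutativeSemiring.Binomial as Binomial
import Algebra.Properties.Semiring.Mult as SemiringMult
import Algebra.Solver.Ring
import Algebra.Solver.Ring.AlmostCommutativeRing as ACR
open import Data.Empty using (⊥)
open import Data.Fin as Fin using (Fin; zero; suc)
import Data.Fin.Properties as FinP
open import Data.Fin.Permutation using (Permutation; permutation)
open import Data.Integer as ℤ using (ℤ; +_; -[1+_]; _⊖_; _◃_)
import Data.Integer.Properties as ℤP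
open import Data.Maybe using (Maybe; just; nothing)
open import Data.Nat as ℕ using (ℕ; zero; suc; _!)
open import Data.Nat.Combinatorics using (_C_; nCn≡1; nCk≡n!/k![n-k]!; k![n∸k]!∣n!)
open import Data.Nat.DivMod using (m/n*n≡m)
open import Data.Nat.Divisibility as ℕ∣ using (_∣_; divides; m∣m*n)
open import Data.Nat.GCD using (gcd; GCD; gcd-GCD; gcd[m,n]∣m; gcd[m,n]∣n; gcd[m,n]≡0⇒n≡0; module Bézout)
open import Data.Nat.Primality using (Prime; euclidsLemma; prime⇒nonTrivial; prime⇒nonZero)
open import Data.Nat.Solver using (module +-*-Solver)
import Data.Nat.Properties as ℕP
open import Data.Product using (∃; _×_; _,_; proj₁; proj₂)
import Data.Sign as Sign
open import Data.Sum using (_⊎_; inj₁; inj₂)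
open import Data.Vec.Functional using (replicate; removeAt)
open import Function.Base using (_∘_)
open import Function.Bundles using (_⇔_; mk⇔)
open import Function.Definitions using (Injective; Surjective)
open import Relation.Binary.PropositionalEquality as ≡ using (_≡_; _≢_)
open import Relation.Binary.Definitions using (Decidable)
open import Relation.Nullary using (¬_; ¬?; Dec; yes; no)
open import Relation.Nullary.Decidable using (decidable-stable)
open import Relation.Nullary.Negation using (contradiction)

open import Defs

Fin-injective⇒surjective : ∀ {n} {f : Fin n → Fin n} → Injective _≡_ _≡_ f → ∀ y → ∃ λ x → f x ≡ y
Fin-injective⇒surjective {zero} inj ()
Fin-injective⇒surjective {suc n} {f} inj y with FinP.any? (λ i → f i FinP.≟ y)
... | yes hit = hit
... | no miss = contradiction (FinP.injective⇒≤ punchOut-injective) ℕP.1+n≰n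
  where
  punchOut-injective : Injective _≡_ _≡_ (λ i → Fin.punchOut {i = y} (λ e → miss (i , ≡.sym e)))
  punchOut-injective {i} {j} e = inj (FinP.punchOut-injective {i = y} (λ e → miss (i , ≡.sym e)) (λ e → miss (j , ≡.sym e)) e)

prime∤! : ∀ {p} → Prime p → ∀ {j} → j ℕ.< p → ¬ p ∣ j !
prime∤! p-prime {zero} _ p∣1 = ℕ.nonTrivial⇒≢1 {{prime⇒nonTrivial p-prime}} (ℕ∣.∣1⇒≡1 p∣1)
prime∤! p-prime {suc j} j<p p∣j! with euclidsLemma (suc j) (j !) p-prime p∣j!
... | inj₁ p∣1+j = ℕP.<⇒≱ j<p (ℕ∣.∣⇒≤ p∣1+j)
... | inj₂ p∣j! = prime∤! p-prime (ℕP.<-trans (ℕP.n<1+n _) j<p) p∣j!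

n∣nCk*k!*[n∸k]! : ∀ {n k} → k ℕ.≤ suc n → suc n ∣ (suc n C k) ℕ.* (k ! ℕ.* (suc n ℕ.∸ k) !)
n∣nCk*k!*[n∸k]! {n} {k} k≤n = ≡.subst (suc n ∣_) (≡.sym (≡.trans
  (≡.cong (ℕ._* (k ! ℕ.* (suc n ℕ.∸ k) !)) (nCk≡n!/k![n-k]! k≤n))
  (m/n*n≡m (k![n∸k]!∣n! k≤n)))) (m∣m*n (n !))
  where instance _ = ℕP._!*_!≢0 k (suc n ℕ.∸ k)

p∣pCk : ∀ {p k} → Prime p → 0 ℕ.< k → k ℕ.< p → p ∣ p C k
p∣pCk {suc p′} {k} p-prime 0<k k<p
  with euclidsLemma (suc p′ C k) (k ! ℕ.* (suc p′ ℕ.∸ k) !) p-prime (n∣nCk*k!*[n∸k]! (ℕP.<⇒≤ k<p))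
... | inj₁ p∣pCk = p∣pCk
... | inj₂ p∣k!*[p∸k]! with euclidsLemma (k !) ((suc p′ ℕ.∸ k) !) p-prime p∣k!*[p∸k]!
...   | inj₁ p∣k! = contradiction p∣k! (prime∤! p-prime k<p)
...   | inj₂ p∣[p∸k]! = contradiction p∣[p∸k]! (prime∤! p-prime (ℕP.∸-monoʳ-< 0<k (ℕP.<⇒≤ k<p)))

-- ℤ is interpreted with the multiplication optimised for type-checking, so that con (+ 2) evaluates to
-- 1# + 1#, the numeral 2 as it is written in f6.
module IntegerCoefficientSolver {c ℓ} (R : CommutativeRing c ℓ) where
  open CommutativeRing R
  open import Algebra.Properties.Semiring.Mult.TCOptimised semiring
    using (×1-homo-*; ×-homo-+; 1+×) renaming (_×_ to _·_)
  open import Algebra.Properties.Ring ring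
    using (-0#≈0#; -‿distribˡ-*; -‿distribʳ-*; -‿involutive; -‿anti-homo-+)
  open import Relation.Binary.Reasoning.Setoid setoid

  private
    ⟦_⟧ : ℤ → Carrier
    ⟦ + n ⟧ = n · 1#
    ⟦ -[1+ n ] ⟧ = - (suc n · 1#)

    ⊖-homo : ∀ m n → ⟦ m ⊖ n ⟧ ≈ m · 1# - n · 1#
    ⊖-homo m zero = sym (trans (+-congˡ -0#≈0#) (+-identityʳ _))
    ⊖-homo zero (suc n) = sym (+-identityˡ _)
    ⊖-homo (suc m) (suc n) = begin
      ⟦ suc m ⊖ suc n ⟧                ≡⟨ ≡.cong ⟦_⟧ (ℤP.[1+m]⊖[1+n]≡m⊖n m n) ⟩
      ⟦ m ⊖ n ⟧                        ≈⟨ ⊖-homo m n ⟩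
      m · 1# - n · 1#                   ≈⟨ sym (+-identityˡ _) ⟩
      0# + (m · 1# - n · 1#)            ≈⟨ +-congʳ (sym (-‿inverseʳ 1#)) ⟩
      (1# - 1#) + (m · 1# - n · 1#)     ≈⟨ +-assoc _ _ _ ⟩
      1# + (- 1# + (m · 1# - n · 1#))   ≈⟨ +-congˡ (+-comm _ _) ⟩
      1# + ((m · 1# - n · 1#) - 1#)     ≈⟨ +-congˡ (+-assoc _ _ _) ⟩
      1# + (m · 1# + (- (n · 1#) - 1#)) ≈⟨ sym (+-assoc _ _ _) ⟩
      (1# + m · 1#) + (- (n · 1#) - 1#) ≈⟨ +-cong (sym (1+× m 1#)) (trans (sym (-‿anti-homo-+ 1# (n · 1#))) (-‿cong (sym (1+× n 1#)))) ⟩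
      suc m · 1# - suc n · 1#           ∎

    +-homo : ∀ i j → ⟦ i ℤ.+ j ⟧ ≈ ⟦ i ⟧ + ⟦ j ⟧
    +-homo (+ m) (+ n) = ×-homo-+ 1# m n
    +-homo (+ m) -[1+ n ] = ⊖-homo m (suc n)
    +-homo -[1+ m ] (+ n) = trans (⊖-homo n (suc m)) (+-comm _ _)
    +-homo -[1+ m ] -[1+ n ] = begin
      - (suc (suc (m ℕ.+ n)) · 1#)      ≡⟨ ≡.cong (λ k → - (suc k · 1#)) (≡.sym (ℕP.+-suc m n)) ⟩
      - ((suc m ℕ.+ suc n) · 1#)        ≈⟨ -‿cong (×-homo-+ 1# (suc m) (suc n)) ⟩
      - (suc m · 1# + suc n · 1#)       ≈⟨ -‿cong (+-comm _ _) ⟩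
      - (suc n · 1# + suc m · 1#)       ≈⟨ -‿anti-homo-+ _ _ ⟩
      - (suc m · 1#) + - (suc n · 1#)   ∎

    -‿homo : ∀ i → ⟦ ℤ.- i ⟧ ≈ - ⟦ i ⟧
    -‿homo (+ zero) = sym -0#≈0#
    -‿homo (+ suc n) = refl
    -‿homo -[1+ n ] = sym (-‿involutive _)

    signed : Sign.Sign → Carrier → Carrier
    signed Sign.+ x = x
    signed Sign.- x = - x

    ◃-homo : ∀ s n → ⟦ s ◃ n ⟧ ≈ signed s (n · 1#)
    ◃-homo Sign.+ zero = refl
    ◃-homo Sign.- zero = sym -0#≈0#
    ◃-homo Sign.+ (suc n) = refl
    ◃-homo Sign.- (suc n) = refl

    signed-abs : ∀ i → ⟦ i ⟧ ≈ signed (ℤ.sign i) (ℤ.∣ i ∣ · 1#)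
    signed-abs (+ zero) = refl
    signed-abs (+ suc n) = refl
    signed-abs -[1+ n ] = refl

    signed-* : ∀ s t x y → signed (s Sign.* t) (x * y) ≈ signed s x * signed t y
    signed-* Sign.+ Sign.+ x y = refl
    signed-* Sign.+ Sign.- x y = -‿distribʳ-* x y
    signed-* Sign.- Sign.+ x y = -‿distribˡ-* x y
    signed-* Sign.- Sign.- x y = begin
      x * y           ≈⟨ sym (-‿involutive _) ⟩
      - - (x * y)     ≈⟨ -‿cong (-‿distribʳ-* x y) ⟩
      - (x * - y)     ≈⟨ -‿distribˡ-* x (- y) ⟩
      - x * - y       ∎

    *-homo : ∀ i j → ⟦ i ℤ.* j ⟧ ≈ ⟦ i ⟧ * ⟦ j ⟧
    *-homo i j = begin
      ⟦ s ◃ ℤ.∣ i ∣ ℕ.* ℤ.∣ j ∣ ⟧                       ≈⟨ ◃-homo s (ℤ.∣ i ∣ ℕ.* ℤ.∣ j ∣) ⟩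
      signed s ((ℤ.∣ i ∣ ℕ.* ℤ.∣ j ∣) · 1#)             ≈⟨ signed-cong s (×1-homo-* ℤ.∣ i ∣ ℤ.∣ j ∣) ⟩
      signed s ((ℤ.∣ i ∣ · 1#) * (ℤ.∣ j ∣ · 1#))        ≈⟨ signed-* (ℤ.sign i) (ℤ.sign j) _ _ ⟩
      signed (ℤ.sign i) (ℤ.∣ i ∣ · 1#) * signed (ℤ.sign j) (ℤ.∣ j ∣ · 1#) ≈⟨ sym (*-cong (signed-abs i) (signed-abs j)) ⟩
      ⟦ i ⟧ * ⟦ j ⟧                                     ∎
      where
      s = ℤ.sign i Sign.* ℤ.sign j
      signed-cong : ∀ s {x y} → x ≈ y → signed s x ≈ signed s y
      signed-cong Sign.+ x≈y = x≈y
      signed-cong Sign.- x≈y = -‿cong x≈y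

    ℤ⟶R : ACR._-Raw-AlmostCommutative⟶_ ℤ.+-*-rawRing (ACR.fromCommutativeRing R)
    ℤ⟶R = record
      { ⟦_⟧ = ⟦_⟧ ; +-homo = +-homo ; *-homo = *-homo ; -‿homo = -‿homo ; 0-homo = refl ; 1-homo = refl }

    ⟦⟧-≟ : ∀ i j → Maybe (⟦ i ⟧ ≈ ⟦ j ⟧)
    ⟦⟧-≟ i j with i ℤ.≟ j
    ... | yes ≡.refl = just refl
    ... | no _ = nothing

  open Algebra.Solver.Ring ℤ.+-*-rawRing (ACR.fromCommutativeRing R) ℤ⟶R ⟦⟧-≟ public
    using (solve; con; _:+_; _:-_; :-_; _:*_; _:=_)

p^[3*m]≡p^m*p^m*p^m : ∀ p m → p ℕ.^ (3 ℕ.* m) ≡ p ℕ.^ m ℕ.* p ℕ.^ m ℕ.* p ℕ.^ m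
p^[3*m]≡p^m*p^m*p^m p m = begin
  p ℕ.^ (3 ℕ.* m)   ≡⟨ ≡.cong (p ℕ.^_) (ℕP.*-comm 3 m) ⟩
  p ℕ.^ (m ℕ.* 3)   ≡⟨ ≡.sym (ℕP.^-*-assoc p m 3) ⟩
  (p ℕ.^ m) ℕ.^ 3   ≡⟨ solve 1 (λ q → q :^ 3 := q :* q :* q) ≡.refl (p ℕ.^ m) ⟩
  p ℕ.^ m ℕ.* p ℕ.^ m ℕ.* p ℕ.^ m ∎
  where
  open ≡.≡-Reasoning
  open +-*-Solver

n*n*n∸1≡[n*n+n+1]*[n∸1] : ∀ n → n ℕ.* n ℕ.* n ℕ.∸ 1 ≡ (n ℕ.* n ℕ.+ n ℕ.+ 1) ℕ.* (n ℕ.∸ 1)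
n*n*n∸1≡[n*n+n+1]*[n∸1] zero = ≡.refl
n*n*n∸1≡[n*n+n+1]*[n∸1] (suc r) = ≡.cong (ℕ._∸ 1) (solve 1 (λ r → (con 1 :+ r) :* (con 1 :+ r) :* (con 1 :+ r)
  := con 1 :+ ((con 1 :+ r) :* (con 1 :+ r) :+ (con 1 :+ r) :+ con 1) :* r) ≡.refl r)
  where open +-*-Solver

module Frobenius {c ℓ} (R : CommutativeRing c ℓ) where
  open CommutativeRing R hiding (zero)
  open SemiringMult semiring using (×-assoc-*; ×-assocˡ; ×-congʳ) renaming (_×_ to _·_)
  open import Algebra.Properties.Semiring.Exp semiring using (_^_; ^-congˡ; ^-assocʳ)
  open Binomial commutativeSemiring using (theorem; binomialTerm)
  open MonoidSum +-commutativeMonoid using (sum; sum-init-last; sum-cong-≋; sum-replicate-zero)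
  open import Relation.Binary.Reasoning.Setoid setoid

  p∣n⇒n·x≈0 : ∀ {p n} x → p · 1# ≈ 0# → p ∣ n → n · x ≈ 0#
  p∣n⇒n·x≈0 {p} x char-p (divides d ≡.refl) = begin
    (d ℕ.* p) · x       ≈⟨ sym (×-assocˡ x d p) ⟩
    d · (p · x)         ≈⟨ ×-congʳ d (trans (×-congʳ p (sym (*-identityˡ x))) (sym (×-assoc-* p 1# x))) ⟩
    d · ((p · 1#) * x)  ≈⟨ ×-congʳ d (trans (*-congʳ char-p) (zeroˡ x)) ⟩
    d · 0#              ≈⟨ n·0≈0 d ⟩
    0#                  ∎
    where
    n·0≈0 : ∀ n → n · 0# ≈ 0#
    n·0≈0 zero = refl
    n·0≈0 (suc n) = trans (+-identityˡ _) (n·0≈0 n)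

  ^p-homo-+ : ∀ {p} → Prime p → p · 1# ≈ 0# → ∀ x y → (x + y) ^ p ≈ x ^ p + y ^ p
  ^p-homo-+ {zero} p-prime = contradiction (ℕ.nonTrivial⇒n>1 0 {{prime⇒nonTrivial p-prime}}) λ ()
  ^p-homo-+ {suc n} p-prime char-p x y = begin
    (x + y) ^ suc n                                            ≈⟨ theorem (suc n) x y ⟩
    t zero + sum (λ i → t (suc i))                             ≈⟨ +-congˡ (sum-init-last (λ i → t (suc i))) ⟩
    t zero + (sum (λ j → t (suc (Fin.inject₁ j))) + t (Fin.fromℕ (suc n)))
      ≈⟨ +-congˡ (+-congʳ (trans (sum-cong-≋ middle≈0) (sum-replicate-zero n))) ⟩
    t zero + (0# + t (Fin.fromℕ (suc n)))                      ≈⟨ +-cong first (trans (+-identityˡ _) last) ⟩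
    y ^ suc n + x ^ suc n                                      ≈⟨ +-comm _ _ ⟩
    x ^ suc n + y ^ suc n                                      ∎
    where
    t = binomialTerm x y (suc n)
    middle≈0 : ∀ j → t (suc (Fin.inject₁ j)) ≈ 0#
    middle≈0 j = p∣n⇒n·x≈0 _ char-p (p∣pCk p-prime (ℕ.s≤s ℕ.z≤n)
      (≡.subst (ℕ._< suc n) (≡.sym (≡.cong suc (FinP.toℕ-inject₁ j))) (ℕ.s≤s (FinP.toℕ<n j))))
    first : t zero ≈ y ^ suc n
    first = trans (+-identityʳ _) (*-identityˡ _)
    last : t (Fin.fromℕ (suc n)) ≈ x ^ suc n
    last = begin
      t (Fin.fromℕ (suc n))
        ≡⟨ ≡.cong (λ k → (suc n C k) · (x ^ k * y ^ (suc n ℕ.∸ k))) (FinP.toℕ-fromℕ (suc n)) ⟩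
      (suc n C suc n) · (x ^ suc n * y ^ (suc n ℕ.∸ suc n))
        ≡⟨ ≡.cong₂ (λ a b → a · (x ^ suc n * y ^ b)) (nCn≡1 (suc n)) (ℕP.n∸n≡0 (suc n)) ⟩
      1 · (x ^ suc n * 1#)                                ≈⟨ trans (+-identityʳ _) (*-identityʳ _) ⟩
      x ^ suc n                                           ∎

  ^[p^k]-homo-+ : ∀ {p} → Prime p → p · 1# ≈ 0# → ∀ k x y → (x + y) ^ (p ℕ.^ k) ≈ x ^ (p ℕ.^ k) + y ^ (p ℕ.^ k)
  ^[p^k]-homo-+ p-prime char-p zero x y = trans (*-identityʳ _) (sym (+-cong (*-identityʳ x) (*-identityʳ y)))
  ^[p^k]-homo-+ {p} p-prime char-p (suc k) x y = begin
    (x + y) ^ (p ℕ.* p ℕ.^ k)                 ≈⟨ ^-reassoc (x + y) ⟩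
    ((x + y) ^ (p ℕ.^ k)) ^ p                 ≈⟨ ^-congˡ p (^[p^k]-homo-+ p-prime char-p k x y) ⟩
    (x ^ (p ℕ.^ k) + y ^ (p ℕ.^ k)) ^ p       ≈⟨ ^p-homo-+ p-prime char-p _ _ ⟩
    (x ^ (p ℕ.^ k)) ^ p + (y ^ (p ℕ.^ k)) ^ p ≈⟨ sym (+-cong (^-reassoc x) (^-reassoc y)) ⟩
    x ^ (p ℕ.* p ℕ.^ k) + y ^ (p ℕ.* p ℕ.^ k) ∎
    where
    ^-reassoc : ∀ z → z ^ (p ℕ.* p ℕ.^ k) ≈ (z ^ (p ℕ.^ k)) ^ p
    ^-reassoc z = trans (reflexive (≡.cong (z ^_) (ℕP.*-comm p (p ℕ.^ k)))) (sym (^-assocʳ z (p ℕ.^ k) p))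

module RootsOfUnity {c ℓ} (R : CommutativeRing c ℓ) where
  open CommutativeRing R hiding (zero)
  open import Algebra.Properties.Semiring.Exp semiring using (_^_; ^-congˡ; ^-assocʳ)
  open import Relation.Binary.Reasoning.Setoid setoid
  open Bézout using (Identity; +-; -+)

  1^n≈1 : ∀ n → 1# ^ n ≈ 1#
  1^n≈1 zero = refl
  1^n≈1 (suc n) = trans (*-identityˡ _) (1^n≈1 n)

  ^[k*n]≈1 : ∀ {n v} k → v ^ n ≈ 1# → v ^ (k ℕ.* n) ≈ 1#
  ^[k*n]≈1 {n} {v} k vⁿ≈1 = begin
    v ^ (k ℕ.* n)  ≡⟨ ≡.cong (v ^_) (ℕP.*-comm k n) ⟩
    v ^ (n ℕ.* k)  ≈⟨ sym (^-assocʳ v n k) ⟩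
    (v ^ n) ^ k    ≈⟨ ^-congˡ k vⁿ≈1 ⟩
    1# ^ k         ≈⟨ 1^n≈1 k ⟩
    1#             ∎

  coprime⇒^-injective-on-μ : ∀ {n s t u} → gcd s n ≡ 1 → t ^ n ≈ 1# → u ^ n ≈ 1# → t ^ s ≈ u ^ s → t ≈ u
  coprime⇒^-injective-on-μ {n} {s} {t} {u} gcd≡1 tⁿ≈1 uⁿ≈1 tˢ≈uˢ =
    from-identity (Bézout.identity (≡.subst (GCD s n) gcd≡1 (gcd-GCD s n)))
    where
    from-identity : Identity 1 s n → t ≈ u
    from-identity (+- x y eq) = begin
      t                ≈⟨ sym (v^[x*s]≈v tⁿ≈1) ⟩
      t ^ (x ℕ.* s)    ≈⟨ ^-swap t ⟩
      (t ^ s) ^ x      ≈⟨ ^-congˡ x tˢ≈uˢ ⟩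
      (u ^ s) ^ x      ≈⟨ sym (^-swap u) ⟩
      u ^ (x ℕ.* s)    ≈⟨ v^[x*s]≈v uⁿ≈1 ⟩
      u                ∎
      where
      v^[x*s]≈v : ∀ {v} → v ^ n ≈ 1# → v ^ (x ℕ.* s) ≈ v
      v^[x*s]≈v {v} vⁿ≈1 = begin
        v ^ (x ℕ.* s)          ≡⟨ ≡.cong (v ^_) (≡.sym eq) ⟩
        v * v ^ (y ℕ.* n)      ≈⟨ *-congˡ (^[k*n]≈1 y vⁿ≈1) ⟩
        v * 1#                 ≈⟨ *-identityʳ v ⟩
        v                      ∎
      ^-swap : ∀ v → v ^ (x ℕ.* s) ≈ (v ^ s) ^ x
      ^-swap v = trans (reflexive (≡.cong (v ^_) (ℕP.*-comm x s))) (sym (^-assocʳ v s x))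
    from-identity (-+ x y eq) = begin
      t                    ≈⟨ sym (*-identityʳ t) ⟩
      t * 1#               ≈⟨ *-congˡ (sym (v*[vˢ]ˣ≈1 uⁿ≈1)) ⟩
      t * (u * (u ^ s) ^ x) ≈⟨ *-congˡ (*-congˡ (^-congˡ x (sym tˢ≈uˢ))) ⟩
      t * (u * (t ^ s) ^ x) ≈⟨ sym (*-assoc _ _ _) ⟩
      (t * u) * (t ^ s) ^ x ≈⟨ *-congʳ (*-comm t u) ⟩
      (u * t) * (t ^ s) ^ x ≈⟨ *-assoc _ _ _ ⟩
      u * (t * (t ^ s) ^ x) ≈⟨ *-congˡ (v*[vˢ]ˣ≈1 tⁿ≈1) ⟩
      u * 1#               ≈⟨ *-identityʳ u ⟩
      u                    ∎
      where
      v*[vˢ]ˣ≈1 : ∀ {v} → v ^ n ≈ 1# → v * (v ^ s) ^ x ≈ 1#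
      v*[vˢ]ˣ≈1 {v} vⁿ≈1 = begin
        v * (v ^ s) ^ x     ≈⟨ *-congˡ (^-assocʳ v s x) ⟩
        v ^ suc (s ℕ.* x)   ≡⟨ ≡.cong (λ k → v ^ suc k) (ℕP.*-comm s x) ⟩
        v ^ suc (x ℕ.* s)   ≡⟨ ≡.cong (v ^_) eq ⟩
        v ^ (y ℕ.* n)       ≈⟨ ^[k*n]≈1 y vⁿ≈1 ⟩
        1#                  ∎

module DecidableField {c ℓ} (F : CommutativeRing c ℓ)
  (_≟_ : Decidable (CommutativeRing._≈_ F))
  (1≉0 : CommutativeRing._≉_ F (CommutativeRing.1# F) (CommutativeRing.0# F))
  (inverse : ∀ x → CommutativeRing._≉_ F x (CommutativeRing.0# F) →
             ∃ λ y → CommutativeRing._≈_ F (CommutativeRing._*_ F x y) (CommutativeRing.1# F)) where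

  open CommutativeRing F hiding (zero)
  open import Algebra.Properties.Semiring.Exp semiring using (_^_)
  open import Relation.Binary.Reasoning.Setoid setoid
  open IntegerCoefficientSolver F
  open import Algebra.Properties.Ring ring using (x∙y⁻¹≈ε⇒x≈y)

  *-cancelˡ : ∀ {x y z} → x ≉ 0# → x * y ≈ x * z → y ≈ z
  *-cancelˡ {x} {y} {z} x≉0 xy≈xz = begin
    y               ≈⟨ sym (*-identityˡ y) ⟩
    1# * y          ≈⟨ *-congʳ (sym x⁻¹*x≈1) ⟩
    (x⁻¹ * x) * y   ≈⟨ *-assoc _ _ _ ⟩
    x⁻¹ * (x * y)   ≈⟨ *-congˡ xy≈xz ⟩
    x⁻¹ * (x * z)   ≈⟨ sym (*-assoc _ _ _) ⟩
    (x⁻¹ * x) * z   ≈⟨ *-congʳ x⁻¹*x≈1 ⟩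
    1# * z          ≈⟨ *-identityˡ z ⟩
    z               ∎
    where
    x⁻¹ = proj₁ (inverse x x≉0)
    x⁻¹*x≈1 : x⁻¹ * x ≈ 1#
    x⁻¹*x≈1 = trans (*-comm _ _) (proj₂ (inverse x x≉0))

  x*y≈0⇒x≈0⊎y≈0 : ∀ {x y} → x * y ≈ 0# → x ≈ 0# ⊎ y ≈ 0#
  x*y≈0⇒x≈0⊎y≈0 {x} {y} xy≈0 with x ≟ 0#
  ... | yes x≈0 = inj₁ x≈0
  ... | no x≉0 = inj₂ (*-cancelˡ x≉0 (trans xy≈0 (sym (zeroʳ x))))

  x*y≈0∧x≉0⇒y≈0 : ∀ {x y} → x * y ≈ 0# → x ≉ 0# → y ≈ 0#
  x*y≈0∧x≉0⇒y≈0 xy≈0 x≉0 with x*y≈0⇒x≈0⊎y≈0 xy≈0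
  ... | inj₁ x≈0 = contradiction x≈0 x≉0
  ... | inj₂ y≈0 = y≈0

  x*y≈0∧y≉0⇒x≈0 : ∀ {x y} → x * y ≈ 0# → y ≉ 0# → x ≈ 0#
  x*y≈0∧y≉0⇒x≈0 xy≈0 = x*y≈0∧x≉0⇒y≈0 (trans (*-comm _ _) xy≈0)

  x*x≈0⇒x≈0 : ∀ {x} → x * x ≈ 0# → x ≈ 0#
  x*x≈0⇒x≈0 xx≈0 with x*y≈0⇒x≈0⊎y≈0 xx≈0
  ... | inj₁ x≈0 = x≈0
  ... | inj₂ x≈0 = x≈0

  x*y≉0 : ∀ {x y} → x ≉ 0# → y ≉ 0# → x * y ≉ 0#
  x*y≉0 x≉0 y≉0 xy≈0 = y≉0 (x*y≈0∧x≉0⇒y≈0 xy≈0 x≉0)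

  x^n≉0 : ∀ {x} n → x ≉ 0# → x ^ n ≉ 0#
  x^n≉0 zero x≉0 = 1≉0
  x^n≉0 (suc n) x≉0 = x*y≉0 x≉0 (x^n≉0 n x≉0)

  x^n≈0⇒x≈0 : ∀ {x} n → x ^ n ≈ 0# → x ≈ 0#
  x^n≈0⇒x≈0 {x} n xⁿ≈0 with x ≟ 0#
  ... | yes x≈0 = x≈0
  ... | no x≉0 = contradiction xⁿ≈0 (x^n≉0 n x≉0)

  -- Polynomial n l g: g is a polynomial function of degree ≤ n, in Horner form, whose coefficient of X ^ n is l.
  data Polynomial : ℕ → Carrier → (Carrier → Carrier) → Set (c ⊔ ℓ) where
    constant : ∀ {l g} → (∀ x → g x ≈ l) → Polynomial 0 l g
    horner : ∀ {n l g} a g′ → Polynomial n l g′ → (∀ x → g x ≈ a + x * g′ x) → Polynomial (suc n) l g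

  Polynomial-resp-≗ : ∀ {n l g h} → Polynomial n l g → (∀ x → g x ≈ h x) → Polynomial n l h
  Polynomial-resp-≗ (constant g≈l) g≈h = constant (λ x → trans (sym (g≈h x)) (g≈l x))
  Polynomial-resp-≗ (horner a g′ P eq) g≈h = horner a g′ P (λ x → trans (sym (g≈h x)) (eq x))

  Polynomial-resp-lead : ∀ {n l l′ g} → Polynomial n l g → l ≈ l′ → Polynomial n l′ g
  Polynomial-resp-lead (constant g≈l) l≈l′ = constant (λ x → trans (g≈l x) l≈l′)
  Polynomial-resp-lead (horner a g′ P eq) l≈l′ = horner a g′ (Polynomial-resp-lead P l≈l′) eq

  Polynomial-+ : ∀ {n l l′ g h} → Polynomial n l g → Polynomial n l′ h → Polynomial n (l + l′) (λ x → g x + h x)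
  Polynomial-+ (constant g≈l) (constant h≈l′) = constant (λ x → +-cong (g≈l x) (h≈l′ x))
  Polynomial-+ (horner a g′ P eq) (horner b h′ Q eq′) = horner (a + b) (λ x → g′ x + h′ x) (Polynomial-+ P Q)
    (λ x → trans (+-cong (eq x) (eq′ x))
      (solve 5 (λ a b x u v → (a :+ x :* u) :+ (b :+ x :* v) := (a :+ b) :+ x :* (u :+ v)) refl a b x (g′ x) (h′ x)))

  Polynomial-raise : ∀ {n l g} → Polynomial n l g → Polynomial (suc n) 0# g
  Polynomial-raise {l = l} (constant g≈l) =
    horner l (λ _ → 0#) (constant (λ _ → refl)) (λ x → trans (g≈l x) (sym (trans (+-congˡ (zeroʳ x)) (+-identityʳ l))))
  Polynomial-raise (horner a g′ P eq) = horner a g′ (Polynomial-raise P) eq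

  Polynomial-raise≤ : ∀ {n d l g} → Polynomial n l g → n ℕ.< d → Polynomial d 0# g
  Polynomial-raise≤ P n<d = raise′ (ℕP.<⇒<′ n<d)
    where
    raise′ : ∀ {d} → _ ℕ.<′ d → Polynomial d 0# _
    raise′ ℕ.<′-base = Polynomial-raise P
    raise′ (ℕ.<′-step n<d) = Polynomial-raise (raise′ n<d)

  Polynomial-X^ : ∀ n → Polynomial n 1# (_^ n)
  Polynomial-X^ zero = constant (λ _ → refl)
  Polynomial-X^ (suc n) = horner 0# (_^ n) (Polynomial-X^ n) (λ x → sym (+-identityˡ _))

  Polynomial-monic : ∀ {n d l g} → Polynomial d l g → d ℕ.< n → Polynomial n 1# (λ x → x ^ n + g x)
  Polynomial-monic {n} P d<n = Polynomial-resp-lead (Polynomial-+ (Polynomial-X^ n) (Polynomial-raise≤ P d<n)) (+-identityʳ 1#)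

  Polynomial-X^n-X : ∀ {n} → 1 ℕ.< n → Polynomial n 1# (λ x → x ^ n - x)
  Polynomial-X^n-X = Polynomial-monic (horner 0# (λ _ → - 1#) (constant (λ _ → refl)) -x≈0+x*-1)
    where
    -x≈0+x*-1 : ∀ x → - x ≈ 0# + x * - 1#
    -x≈0+x*-1 x = solve 1 (λ x → :- x := con (+ 0) :+ x :* (:- con (+ 1))) refl x

  divide : ∀ {n l g} → Polynomial (suc n) l g → ∀ r →
           ∃ λ h → Polynomial n l h × (∀ x → g x ≈ (x - r) * h x + g r)
  divide {zero} {l} {g} (horner a g′ (constant g′≈l) eq) r = (λ _ → l) , constant (λ _ → refl) , λ x → begin
    g x                        ≈⟨ eq x ⟩
    a + x * g′ x               ≈⟨ +-congˡ (*-congˡ (g′≈l x)) ⟩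
    a + x * l                  ≈⟨ solve 4 (λ a l x r → a :+ x :* l := (x :- r) :* l :+ (a :+ r :* l)) refl a l x r ⟩
    (x - r) * l + (a + r * l)  ≈⟨ +-congˡ (sym (trans (eq r) (+-congˡ (*-congˡ (g′≈l r))))) ⟩
    (x - r) * l + g r          ∎
  divide {suc n} {l} {g} (horner a g′ P eq) r with divide P r
  ... | h′ , Q , g′≈ = (λ x → g′ r + x * h′ x) , horner (g′ r) h′ Q (λ _ → refl) , λ x → begin
    g x                                          ≈⟨ eq x ⟩
    a + x * g′ x                                 ≈⟨ +-congˡ (*-congˡ (g′≈ x)) ⟩
    a + x * ((x - r) * h′ x + g′ r)
      ≈⟨ solve 5 (λ a x r u v → a :+ x :* ((x :- r) :* u :+ v) := (x :- r) :* (v :+ x :* u) :+ (a :+ r :* v)) refl a x r (h′ x) (g′ r) ⟩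
    (x - r) * (g′ r + x * h′ x) + (a + r * g′ r) ≈⟨ +-congˡ (sym (eq r)) ⟩
    (x - r) * (g′ r + x * h′ x) + g r            ∎

  roots⇒lead≈0 : ∀ {n l g} → Polynomial n l g → (e : Fin (suc n) → Carrier) →
                 (∀ i j → e i ≈ e j → i ≡ j) → (∀ i → g (e i) ≈ 0#) → l ≈ 0#
  roots⇒lead≈0 (constant g≈l) e e-inj roots = trans (sym (g≈l (e zero))) (roots zero)
  roots⇒lead≈0 {suc n} P e e-inj roots with divide P (e zero)
  ... | h , Q , g≈ = roots⇒lead≈0 Q (λ i → e (suc i)) (λ i j eᵢ≈eⱼ → FinP.suc-injective (e-inj _ _ eᵢ≈eⱼ)) h-roots
    where
    h-roots : ∀ i → h (e (suc i)) ≈ 0#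
    h-roots i = x*y≈0∧x≉0⇒y≈0
      (trans (sym (trans (g≈ (e (suc i))) (trans (+-congˡ (roots zero)) (+-identityʳ _)))) (roots (suc i)))
      (λ eᵢ-e₀≈0 → contradiction (e-inj _ _ (x∙y⁻¹≈ε⇒x≈y _ _ eᵢ-e₀≈0)) λ ())

module FiniteField {c ℓ} (F : CommutativeRing c ℓ) (N : ℕ) (F-finite : IsFiniteField F N) where
  open CommutativeRing F hiding (zero)
  open IsFiniteField F-finite
  open SemiringMult semiring using () renaming (_×_ to _·_)
  open import Algebra.Properties.Semiring.Exp semiring using (_^_; ^-congˡ; ^-assocʳ)
  open import Relation.Binary.Reasoning.Setoid setoid

  index : Carrier → Fin N
  index x = proj₁ (enum-surjective x)

  enum-index : ∀ x → enum (index x) ≈ x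
  enum-index x = proj₂ (enum-surjective x)

  index-injective : ∀ {x y} → index x ≡ index y → x ≈ y
  index-injective {x} {y} eq = trans (sym (enum-index x)) (trans (reflexive (≡.cong enum eq)) (enum-index y))

  index-cong : ∀ {x y} → x ≈ y → index x ≡ index y
  index-cong x≈y = enum-injective _ _ (trans (enum-index _) (trans x≈y (sym (enum-index _))))

  _≟_ : ∀ x y → Dec (x ≈ y)
  _≟_ = FinP.inj⇒≟ {S = setoid} (record { to = index ; cong = index-cong ; injective = index-injective })

  open DecidableField F _≟_ 1≉0 inverse public

  injective⇒surjective : ∀ {f} → (∀ {x y} → x ≈ y → f x ≈ f y) → Injective _≈_ _≈_ f → Surjective _≈_ _≈_ f
  injective⇒surjective {f} f-cong f-inj y = enum i , λ z≈ → trans (f-cong z≈) (index-injective f[enum-i]≡y)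
    where
    index∘f∘enum-injective : Injective _≡_ _≡_ (index ∘ f ∘ enum)
    index∘f∘enum-injective eq = enum-injective _ _ (f-inj (index-injective eq))
    i = proj₁ (Fin-injective⇒surjective index∘f∘enum-injective (index y))
    f[enum-i]≡y = proj₂ (Fin-injective⇒surjective index∘f∘enum-injective (index y))

  module Reindex {m ℓm} (M : CommutativeMonoid m ℓm) where
    open CommutativeMonoid M using () renaming (Carrier to A; _≈_ to _≈ᴹ_; trans to transᴹ)
    open MonoidSum M using (sum; ∑-permute; sum-cong-≋)

    ∑-reindex : ∀ (h : Carrier → A) → (∀ {x y} → x ≈ y → h x ≈ᴹ h y) →
                ∀ π π⁻¹ → (∀ {x y} → x ≈ y → π x ≈ π y) → (∀ {x y} → x ≈ y → π⁻¹ x ≈ π⁻¹ y) →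
                (∀ x → π (π⁻¹ x) ≈ x) → (∀ x → π⁻¹ (π x) ≈ x) →
                sum (h ∘ enum) ≈ᴹ sum (h ∘ π ∘ enum)
    ∑-reindex h h-cong π π⁻¹ π-cong π⁻¹-cong ππ⁻¹ π⁻¹π =
      transᴹ (∑-permute (h ∘ enum) σ) (sum-cong-≋ {N} (λ i → h-cong (enum-index (π (enum i)))))
      where
      σ : Permutation N N
      σ = permutation (index ∘ π ∘ enum) (index ∘ π⁻¹ ∘ enum)
        (λ i → enum-injective _ _ (trans (enum-index _) (trans (π-cong (enum-index _)) (ππ⁻¹ _))))
        (λ i → enum-injective _ _ (trans (enum-index _) (trans (π⁻¹-cong (enum-index _)) (π⁻¹π _))))

  open MonoidSum +-commutativeMonoid using (∑-distrib-+; sum-replicate) renaming (sum to ∑)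
  open MonoidSum *-commutativeMonoid using (sum-remove)
    renaming (sum to ∏; sum-cong-≋ to ∏-cong; ∑-distrib-+ to ∏-distrib-*; sum-replicate to ∏-replicate)
  open import Algebra.Properties.Ring ring using (+-identityʳ-unique)

  N·x≈0 : ∀ x → N · x ≈ 0#
  N·x≈0 x = +-identityʳ-unique (∑ enum) (N · x) (sym (begin
    ∑ enum                          ≈⟨ Reindex.∑-reindex +-commutativeMonoid (λ z → z) (λ z≈ → z≈)
                                         (_+ x) (_- x) +-congʳ +-congʳ −x+x (+x−x) ⟩
    ∑ (λ i → enum i + x)            ≈⟨ ∑-distrib-+ enum (replicate N x) ⟩
    ∑ enum + ∑ (replicate N x)      ≈⟨ +-congˡ (sum-replicate N) ⟩
    ∑ enum + N · x                  ∎))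
    where
    −x+x : ∀ z → (z - x) + x ≈ z
    −x+x z = trans (+-assoc _ _ _) (trans (+-congˡ (-‿inverseˡ x)) (+-identityʳ z))
    +x−x : ∀ z → (z + x) - x ≈ z
    +x−x z = trans (+-assoc _ _ _) (trans (+-congˡ (-‿inverseʳ x)) (+-identityʳ z))

  ∏≉0 : ∀ {n} (v : Fin n → Carrier) → (∀ i → v i ≉ 0#) → ∏ v ≉ 0#
  ∏≉0 {zero} v v≉0 = 1≉0
  ∏≉0 {suc n} v v≉0 = x*y≉0 (v≉0 zero) (∏≉0 (v ∘ suc) (v≉0 ∘ suc))

  nonzero : Carrier → Carrier
  nonzero z with z ≟ 0#
  ... | yes _ = 1#
  ... | no _ = z

  nonzero-≉0 : ∀ z → nonzero z ≉ 0#
  nonzero-≉0 z with z ≟ 0#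
  ... | yes _ = 1≉0
  ... | no z≉0 = z≉0

  nonzero-cong : ∀ {z w} → z ≈ w → nonzero z ≈ nonzero w
  nonzero-cong {z} {w} z≈w with z ≟ 0# | w ≟ 0#
  ... | yes _ | yes _ = refl
  ... | yes z≈0 | no w≉0 = contradiction (trans (sym z≈w) z≈0) w≉0
  ... | no z≉0 | yes w≈0 = contradiction (trans z≈w w≈0) z≉0
  ... | no _ | no _ = z≈w

  ∏-nonzero-* : ∀ {y} → y ≉ 0# → ∀ {n} (e : Fin n → Carrier) → (∀ i j → e i ≈ e j → i ≡ j) →
                ∀ {i₀} → e i₀ ≈ 0# → ∏ (nonzero ∘ (y *_) ∘ e) ≈ y ^ (n ℕ.∸ 1) * ∏ (nonzero ∘ e)
  ∏-nonzero-* {y} y≉0 {suc n} e e-inj {i₀} eᵢ₀≈0 = begin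
    ∏ (nonzero ∘ (y *_) ∘ e)                     ≈⟨ ∏-cong (nonzero-* ∘ e) ⟩
    ∏ (λ i → factor (e i) * nonzero (e i))       ≈⟨ ∏-distrib-* (factor ∘ e) (nonzero ∘ e) ⟩
    ∏ (factor ∘ e) * ∏ (nonzero ∘ e)             ≈⟨ *-congʳ (sum-remove {i = i₀} (factor ∘ e)) ⟩
    factor (e i₀) * ∏ (removeAt (factor ∘ e) i₀) * ∏ (nonzero ∘ e)
      ≈⟨ *-congʳ (*-cong (factor-0 eᵢ₀≈0) (∏-cong factor-nonzero)) ⟩
    1# * ∏ (replicate n y) * ∏ (nonzero ∘ e)    ≈⟨ *-congʳ (trans (*-identityˡ _) (∏-replicate n)) ⟩
    y ^ n * ∏ (nonzero ∘ e)                     ∎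
    where
    factor : Carrier → Carrier
    factor z with z ≟ 0#
    ... | yes _ = 1#
    ... | no _ = y
    nonzero-* : ∀ z → nonzero (y * z) ≈ factor z * nonzero z
    nonzero-* z with z ≟ 0# | (y * z) ≟ 0#
    ... | yes _ | yes _ = sym (*-identityˡ 1#)
    ... | yes z≈0 | no yz≉0 = contradiction (trans (*-congˡ z≈0) (zeroʳ y)) yz≉0
    ... | no z≉0 | yes yz≈0 = contradiction yz≈0 (x*y≉0 y≉0 z≉0)
    ... | no _ | no _ = refl
    factor-0 : ∀ {z} → z ≈ 0# → factor z ≈ 1#
    factor-0 {z} z≈0 with z ≟ 0#
    ... | yes _ = refl
    ... | no z≉0 = contradiction z≈0 z≉0
    factor-nonzero : ∀ j → factor (e (Fin.punchIn i₀ j)) ≈ y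
    factor-nonzero j with e (Fin.punchIn i₀ j) ≟ 0#
    ... | yes e≈0 = contradiction (e-inj _ _ (trans e≈0 (sym eᵢ₀≈0))) (FinP.punchInᵢ≢i i₀ j)
    ... | no _ = refl

  -- Multiplication by y permutes the field, so it fixes the product of the units, but it also multiplies
  -- each of the N ∸ 1 units by y.
  x^[N∸1]≈1 : ∀ {y} → y ≉ 0# → y ^ (N ℕ.∸ 1) ≈ 1#
  x^[N∸1]≈1 {y} y≉0 = *-cancelˡ (∏≉0 (nonzero ∘ enum) (nonzero-≉0 ∘ enum)) (begin
    ∏ (nonzero ∘ enum) * y ^ (N ℕ.∸ 1)    ≈⟨ *-comm _ _ ⟩
    y ^ (N ℕ.∸ 1) * ∏ (nonzero ∘ enum)    ≈⟨ sym (∏-nonzero-* y≉0 enum enum-injective (enum-index 0#)) ⟩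
    ∏ (nonzero ∘ (y *_) ∘ enum)           ≈⟨ sym (Reindex.∑-reindex *-commutativeMonoid nonzero nonzero-cong
                                               (y *_) (y⁻¹ *_) *-congˡ *-congˡ y*[y⁻¹*z]≈z y⁻¹*[y*z]≈z) ⟩
    ∏ (nonzero ∘ enum)                    ≈⟨ sym (*-identityʳ _) ⟩
    ∏ (nonzero ∘ enum) * 1#               ∎)
    where
    y⁻¹ = proj₁ (inverse y y≉0)
    y*[y⁻¹*z]≈z : ∀ z → y * (y⁻¹ * z) ≈ z
    y*[y⁻¹*z]≈z z = trans (sym (*-assoc _ _ _)) (trans (*-congʳ (proj₂ (inverse y y≉0))) (*-identityˡ z))
    y⁻¹*[y*z]≈z : ∀ z → y⁻¹ * (y * z) ≈ z
    y⁻¹*[y*z]≈z z = trans (sym (*-assoc _ _ _)) (trans (*-congʳ (trans (*-comm _ _) (proj₂ (inverse y y≉0)))) (*-identityˡ z))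

  N≡1+[N∸1] : N ≡ suc (N ℕ.∸ 1)
  N≡1+[N∸1] = inhabited (index 0#)
    where
    inhabited : ∀ {n} → Fin n → n ≡ suc (n ℕ.∸ 1)
    inhabited zero = ≡.refl
    inhabited (suc _) = ≡.refl

  x^N≈x : ∀ x → x ^ N ≈ x
  x^N≈x x with x ≟ 0#
  ... | yes x≈0 = begin
    x ^ N                      ≡⟨ ≡.cong (x ^_) N≡1+[N∸1] ⟩
    x * x ^ (N ℕ.∸ 1)          ≈⟨ trans (*-congʳ x≈0) (zeroˡ _) ⟩
    0#                         ≈⟨ sym x≈0 ⟩
    x                          ∎
  ... | no x≉0 = begin
    x ^ N                      ≡⟨ ≡.cong (x ^_) N≡1+[N∸1] ⟩
    x * x ^ (N ℕ.∸ 1)          ≈⟨ *-congˡ (x^[N∸1]≈1 x≉0) ⟩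
    x * 1#                     ≈⟨ *-identityʳ x ⟩
    x                          ∎

  ∃-non-root : ∀ {n l g} → Polynomial n l g → l ≉ 0# → n ℕ.< N → (∀ {x y} → x ≈ y → g x ≈ g y) →
               ∃ λ x → g x ≉ 0#
  ∃-non-root {n} {l} {g} P l≉0 n<N g-cong with FinP.any? (λ i → ¬? (g (enum i) ≟ 0#))
  ... | yes (i , gᵢ≉0) = enum i , gᵢ≉0
  ... | no none = contradiction (roots⇒lead≈0 P (λ i → enum (Fin.inject≤ i n<N))
    (λ i j eᵢ≈eⱼ → FinP.inject≤-injective n<N n<N i j (enum-injective _ _ eᵢ≈eⱼ))
    (λ i → decidable-stable (g (enum _) ≟ 0#) (λ gᵢ≉0 → none (_ , gᵢ≉0)))) l≉0

  -- With N ∸ 1 = e * g, take ζ = y ^ e for any y with y ^ (e + 1) ≠ y; such y exist since e + 1 < N.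
  ∃-root-of-unity : ∀ {g} → 1 ℕ.< g → g ∣ N ℕ.∸ 1 → ∃ λ ζ → ζ ≉ 1# × ζ ^ g ≈ 1#
  ∃-root-of-unity 1<g (divides zero N∸1≡0) =
    contradiction (trans (sym (+-identityʳ 1#)) (trans (reflexive (≡.cong (_· 1#) N≡1)) (N·x≈0 1#))) 1≉0
    where
    N≡1 : 1 ≡ N
    N≡1 = ≡.sym (≡.trans N≡1+[N∸1] (≡.cong suc N∸1≡0))
  ∃-root-of-unity {g} 1<g (divides e@(suc _) N∸1≡e*g) = ζ , ζ≉1 , ζ^g≈1
    where
    1+e<N : suc e ℕ.< N
    1+e<N = ≡.subst (suc e ℕ.<_) (≡.sym (≡.trans N≡1+[N∸1] (≡.cong suc N∸1≡e*g))) (ℕ.s≤s (ℕP.m<m*n e g 1<g))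
    non-root = ∃-non-root (Polynomial-X^n-X (ℕ.s≤s (ℕ.s≤s ℕ.z≤n))) 1≉0 1+e<N (λ x≈y → +-cong (^-congˡ (suc e) x≈y) (-‿cong x≈y))
    y = proj₁ non-root
    y^[1+e]-y≉0 : y ^ suc e - y ≉ 0#
    y^[1+e]-y≉0 = proj₂ non-root
    ζ = y ^ e
    ζ≉1 : ζ ≉ 1#
    ζ≉1 ζ≈1 = y^[1+e]-y≉0 (trans (+-congʳ (trans (*-congˡ ζ≈1) (*-identityʳ y))) (-‿inverseʳ y))
    y≉0 : y ≉ 0#
    y≉0 y≈0 = y^[1+e]-y≉0 (begin
      y * y ^ e - y      ≈⟨ +-cong (trans (*-congʳ y≈0) (zeroˡ _)) (-‿cong y≈0) ⟩
      0# - 0#            ≈⟨ -‿inverseʳ 0# ⟩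
      0#                 ∎)
    ζ^g≈1 : ζ ^ g ≈ 1#
    ζ^g≈1 = begin
      (y ^ e) ^ g        ≈⟨ ^-assocʳ y e g ⟩
      y ^ (e ℕ.* g)      ≡⟨ ≡.cong (y ^_) (≡.sym N∸1≡e*g) ⟩
      y ^ (N ℕ.∸ 1)      ≈⟨ x^[N∸1]≈1 y≉0 ⟩
      1#                 ∎

  p^k≡N⇒p·1≈0 : ∀ {p k} → p ℕ.^ k ≡ N → p · 1# ≈ 0#
  p^k≡N⇒p·1≈0 {p} {k} p^k≡N = x^n≈0⇒x≈0 k (begin
    (p · 1#) ^ k      ≈⟨ sym (^-homo k) ⟩
    (p ℕ.^ k) · 1#    ≡⟨ ≡.cong (_· 1#) p^k≡N ⟩
    N · 1#            ≈⟨ N·x≈0 1# ⟩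
    0#                ∎)
    where
    open SemiringMult semiring using (×1-homo-*)
    ^-homo : ∀ k → (p ℕ.^ k) · 1# ≈ (p · 1#) ^ k
    ^-homo zero = +-identityʳ 1#
    ^-homo (suc k) = trans (×1-homo-* p (p ℕ.^ k)) (*-congˡ (^-homo k))

module CubicExtension {c ℓ} (F : CommutativeRing c ℓ) {p m : ℕ} (p-prime : Prime p) (1≤m : 1 ℕ.≤ m)
  (F-finite : IsFiniteField F (p ℕ.^ (3 ℕ.* m))) where

  open CommutativeRing F hiding (zero)
  open IsFiniteField F-finite using (1≉0)
  open FiniteField F (p ℕ.^ (3 ℕ.* m)) F-finite public
  open Frobenius F using (^[p^k]-homo-+)
  open SemiringMult semiring using () renaming (_×_ to _·_)
  open RootsOfUnity F using (1^n≈1; ^[k*n]≈1; coprime⇒^-injective-on-μ)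
  open import Algebra.Properties.Semiring.Exp semiring using (_^_; ^-congˡ; ^-assocʳ)
  open import Algebra.Properties.CommutativeSemiring.Exp commutativeSemiring using (^-distrib-*)
  open import Algebra.Properties.Ring ring using (x+x≈x⇒x≈0; +-inverseˡ-unique)
  open import Relation.Binary.Reasoning.Setoid setoid
  open IntegerCoefficientSolver F

  q : ℕ
  q = p ℕ.^ m

  N : ℕ
  N = p ℕ.^ (3 ℕ.* m)

  1<q : 1 ℕ.< q
  1<q = ℕP.<-≤-trans (ℕ.nonTrivial⇒n>1 p {{prime⇒nonTrivial p-prime}})
    (≡.subst (ℕ._≤ q) (ℕP.*-identityʳ p) (ℕP.^-monoʳ-≤ p {{prime⇒nonZero p-prime}} 1≤m))

  instance
    q≢0 : ℕ.NonZero q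
    q≢0 = ℕP.m^n≢0 p m {{prime⇒nonZero p-prime}}
    q*q≢0 : ℕ.NonZero (q ℕ.* q)
    q*q≢0 = ℕP.m*n≢0 q q

  N≡q*q*q : N ≡ q ℕ.* q ℕ.* q
  N≡q*q*q = p^[3*m]≡p^m*p^m*p^m p m

  q∸1∣N∸1 : (q ℕ.∸ 1) ∣ (N ℕ.∸ 1)
  q∸1∣N∸1 = divides (q ℕ.* q ℕ.+ q ℕ.+ 1) (≡.trans (≡.cong (ℕ._∸ 1) N≡q*q*q) (n*n*n∸1≡[n*n+n+1]*[n∸1] q))

  char-p : p · 1# ≈ 0#
  char-p = p^k≡N⇒p·1≈0 {p} {3 ℕ.* m} ≡.refl

  φ : Carrier → Carrier
  φ x = x ^ q

  φ-cong : ∀ {x y} → x ≈ y → φ x ≈ φ y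
  φ-cong = ^-congˡ q

  φ-+ : ∀ x y → φ (x + y) ≈ φ x + φ y
  φ-+ = ^[p^k]-homo-+ p-prime char-p m

  φ-* : ∀ x y → φ (x * y) ≈ φ x * φ y
  φ-* x y = ^-distrib-* x y q

  φ-1 : φ 1# ≈ 1#
  φ-1 = 1^n≈1 q

  φ-0 : φ 0# ≈ 0#
  φ-0 = x+x≈x⇒x≈0 (φ 0#) (sym (trans (φ-cong (sym (+-identityʳ 0#))) (φ-+ 0# 0#)))

  φ-neg : ∀ x → φ (- x) ≈ - φ x
  φ-neg x = +-inverseˡ-unique (φ (- x)) (φ x) (trans (sym (φ-+ (- x) x)) (trans (φ-cong (-‿inverseˡ x)) φ-0))

  φ-sub : ∀ x y → φ (x - y) ≈ φ x - φ y
  φ-sub x y = trans (φ-+ x (- y)) (+-congˡ (φ-neg y))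

  φ³≈id : ∀ x → φ (φ (φ x)) ≈ x
  φ³≈id x = begin
    ((x ^ q) ^ q) ^ q    ≈⟨ ^-congˡ q (^-assocʳ x q q) ⟩
    (x ^ (q ℕ.* q)) ^ q  ≈⟨ ^-assocʳ x (q ℕ.* q) q ⟩
    x ^ (q ℕ.* q ℕ.* q)  ≡⟨ ≡.cong (x ^_) (≡.sym N≡q*q*q) ⟩
    x ^ N                ≈⟨ x^N≈x x ⟩
    x                    ∎

  φ-injective : ∀ {x y} → φ x ≈ φ y → x ≈ y
  φ-injective {x} {y} φx≈φy = trans (sym (φ³≈id x)) (trans (φ-cong (φ-cong φx≈φy)) (φ³≈id y))

  φ-≉0 : ∀ {x} → x ≉ 0# → φ x ≉ 0#
  φ-≉0 x≉0 φx≈0 = x≉0 (φ-injective (trans φx≈0 (sym φ-0)))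

  𝔽q : Carrier → Set ℓ
  𝔽q u = φ u ≈ u

  𝔽q-+ : ∀ {u v} → 𝔽q u → 𝔽q v → 𝔽q (u + v)
  𝔽q-+ φu≈u φv≈v = trans (φ-+ _ _) (+-cong φu≈u φv≈v)

  𝔽q-* : ∀ {u v} → 𝔽q u → 𝔽q v → 𝔽q (u * v)
  𝔽q-* φu≈u φv≈v = trans (φ-* _ _) (*-cong φu≈u φv≈v)

  𝔽q-neg : ∀ {u} → 𝔽q u → 𝔽q (- u)
  𝔽q-neg φu≈u = trans (φ-neg _) (-‿cong φu≈u)

  𝔽q-1 : 𝔽q 1#
  𝔽q-1 = φ-1

  𝔽q-2 : 𝔽q (1# + 1#)
  𝔽q-2 = 𝔽q-+ 𝔽q-1 𝔽q-1

  𝔽q-^ : ∀ {u} n → 𝔽q u → 𝔽q (u ^ n)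
  𝔽q-^ zero _ = 𝔽q-1
  𝔽q-^ (suc n) 𝔽q-u = 𝔽q-* 𝔽q-u (𝔽q-^ n 𝔽q-u)

  𝔽q-inverse : ∀ {u v} → 𝔽q u → u * v ≈ 1# → 𝔽q v
  𝔽q-inverse {u} {v} φu≈u uv≈1 = *-cancelˡ u≉0 (begin
    u * φ v      ≈⟨ *-congʳ (sym φu≈u) ⟩
    φ u * φ v    ≈⟨ sym (φ-* u v) ⟩
    φ (u * v)    ≈⟨ φ-cong uv≈1 ⟩
    φ 1#         ≈⟨ φ-1 ⟩
    1#           ≈⟨ sym uv≈1 ⟩
    u * v        ∎)
    where
    u≉0 : u ≉ 0#
    u≉0 u≈0 = 1≉0 (trans (sym uv≈1) (trans (*-congʳ u≈0) (zeroˡ v)))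

  T : Carrier → Carrier
  T x = x + φ x + φ (φ x)

  Tr≈T : ∀ x → Tr F q x ≈ T x
  Tr≈T x = +-congˡ (sym (^-assocʳ x q q))

  T-cong : ∀ {x y} → x ≈ y → T x ≈ T y
  T-cong x≈y = +-cong (+-cong x≈y (φ-cong x≈y)) (φ-cong (φ-cong x≈y))

  T∈𝔽q : ∀ x → 𝔽q (T x)
  T∈𝔽q x = begin
    φ (x + φ x + φ (φ x))           ≈⟨ trans (φ-+ _ _) (+-congʳ (φ-+ _ _)) ⟩
    φ x + φ (φ x) + φ (φ (φ x))     ≈⟨ +-congˡ (φ³≈id x) ⟩
    φ x + φ (φ x) + x               ≈⟨ solve 3 (λ a b c → b :+ c :+ a := a :+ b :+ c) refl x (φ x) (φ (φ x)) ⟩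
    x + φ x + φ (φ x)               ∎

  T-φ : ∀ x → T (φ x) ≈ T x
  T-φ x = trans (sym (trans (φ-+ _ _) (+-congʳ (φ-+ _ _)))) (T∈𝔽q x)

  T-+ : ∀ x y → T (x + y) ≈ T x + T y
  T-+ x y = begin
    (x + y) + φ (x + y) + φ (φ (x + y))          ≈⟨ +-cong (+-congˡ (φ-+ x y)) (trans (φ-cong (φ-+ x y)) (φ-+ _ _)) ⟩
    (x + y) + (φ x + φ y) + (φ (φ x) + φ (φ y))
      ≈⟨ solve 6 (λ a b c d e f → (a :+ b) :+ (c :+ d) :+ (e :+ f) := (a :+ c :+ e) :+ (b :+ d :+ f)) refl x y (φ x) (φ y) (φ (φ x)) (φ (φ y)) ⟩
    T x + T y                                    ∎

  T-scale : ∀ {u} x → 𝔽q u → T (u * x) ≈ u * T x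
  T-scale {u} x φu≈u = begin
    u * x + φ (u * x) + φ (φ (u * x))       ≈⟨ +-cong (+-congˡ (φ-scale x)) (trans (φ-cong (φ-scale x)) (φ-scale (φ x))) ⟩
    u * x + u * φ x + u * φ (φ x)
      ≈⟨ solve 4 (λ u a b c → u :* a :+ u :* b :+ u :* c := u :* (a :+ b :+ c)) refl u x (φ x) (φ (φ x)) ⟩
    u * T x                                 ∎
    where
    φ-scale : ∀ y → φ (u * y) ≈ u * φ y
    φ-scale y = trans (φ-* u y) (*-congʳ φu≈u)

  T-0 : T 0# ≈ 0#
  T-0 = trans (+-cong (+-congˡ φ-0) (trans (φ-cong φ-0) φ-0)) (trans (+-identityʳ _) (+-identityʳ 0#))

  T-neg : ∀ x → T (- x) ≈ - T x
  T-neg x = +-inverseˡ-unique (T (- x)) (T x) (trans (sym (T-+ (- x) x)) (trans (T-cong (-‿inverseˡ x)) T-0))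

  T-sub : ∀ x y → T (x - y) ≈ T x - T y
  T-sub x y = trans (T-+ x (- y)) (+-congˡ (T-neg y))

  T-adjoint : ∀ u v → T (u * φ v) ≈ T (φ (φ u) * v)
  T-adjoint u v = begin
    T (u * φ v)                    ≈⟨ sym (trans (T-φ _) (T-φ _)) ⟩
    T (φ (φ (u * φ v)))            ≈⟨ T-cong (trans (φ-cong (φ-* u (φ v))) (trans (φ-* _ _) (*-congˡ (φ³≈id v)))) ⟩
    T (φ (φ u) * v)                ∎

  q≡1+[q∸1] : q ≡ suc (q ℕ.∸ 1)
  q≡1+[q∸1] = ≡.sym (ℕP.suc-pred q)

  𝔽q-unit : ∀ {t} → 𝔽q t → t ≉ 0# → t ^ (q ℕ.∸ 1) ≈ 1#
  𝔽q-unit {t} φt≈t t≉0 = *-cancelˡ t≉0 (begin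
    t * t ^ (q ℕ.∸ 1)   ≡⟨ ≡.cong (t ^_) (≡.sym q≡1+[q∸1]) ⟩
    t ^ q               ≈⟨ φt≈t ⟩
    t                   ≈⟨ sym (*-identityʳ t) ⟩
    t * 1#              ∎)

  𝔽q-^-injective : ∀ {s t u} → 1 ℕ.≤ s → gcd s (q ℕ.∸ 1) ≡ 1 → 𝔽q t → 𝔽q u → t ^ s ≈ u ^ s → t ≈ u
  𝔽q-^-injective {suc s} {t} {u} _ gcd≡1 𝔽q-t 𝔽q-u tˢ≈uˢ = by-cases (t ≟ 0#) (u ≟ 0#)
    where
    zero-case : ∀ {v w} → v ≈ 0# → v ^ suc s ≈ w ^ suc s → v ≈ w
    zero-case v≈0 vˢ≈wˢ = trans v≈0 (sym (x^n≈0⇒x≈0 (suc s) (trans (sym vˢ≈wˢ) (trans (*-congʳ v≈0) (zeroˡ _)))))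
    by-cases : Dec (t ≈ 0#) → Dec (u ≈ 0#) → t ≈ u
    by-cases (yes t≈0) _ = zero-case t≈0 tˢ≈uˢ
    by-cases (no _) (yes u≈0) = sym (zero-case u≈0 (sym tˢ≈uˢ))
    by-cases (no t≉0) (no u≉0) = coprime⇒^-injective-on-μ {q ℕ.∸ 1} {suc s} gcd≡1 (𝔽q-unit 𝔽q-t t≉0) (𝔽q-unit 𝔽q-u u≉0) tˢ≈uˢ

  q<q*q : q ℕ.< q ℕ.* q
  q<q*q = ℕP.m<m*n q q 1<q

  q*q<N : q ℕ.* q ℕ.< N
  q*q<N = ≡.subst (q ℕ.* q ℕ.<_) (≡.sym N≡q*q*q) (ℕP.m<m*n (q ℕ.* q) q 1<q)

  ∃-non-fixed : ∃ λ ω → φ ω - ω ≉ 0#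
  ∃-non-fixed = ∃-non-root (Polynomial-X^n-X 1<q) 1≉0 (ℕP.<-trans q<q*q q*q<N) (λ x≈y → +-cong (φ-cong x≈y) (-‿cong x≈y))

  ∃-T≉0 : ∃ λ x → T x ≉ 0#
  ∃-T≉0 = ∃-non-root (Polynomial-resp-≗ (Polynomial-monic (Polynomial-monic X 1<q) q<q*q) ≈T) 1≉0 q*q<N T-cong
    where
    X : Polynomial 1 1# (λ x → x)
    X = horner 0# (λ _ → 1#) (constant (λ _ → refl)) (λ x → solve 1 (λ x → x := con (+ 0) :+ x :* con (+ 1)) refl x)
    ≈T : ∀ x → x ^ (q ℕ.* q) + (x ^ q + x) ≈ T x
    ≈T x = trans (+-congʳ (sym (^-assocʳ x q q))) (solve 3 (λ a b c → c :+ (b :+ a) := a :+ b :+ c) refl x (φ x) (φ (φ x)))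

  ∃-𝔽q-root-of-unity : ∀ {g} → 1 ℕ.< g → g ∣ q ℕ.∸ 1 → ∃ λ ζ → 𝔽q ζ × ζ ≉ 1# × ζ ^ g ≈ 1#
  ∃-𝔽q-root-of-unity {g} 1<g g∣q∸1@(divides k q∸1≡k*g) with ∃-root-of-unity 1<g (ℕ∣.∣-trans g∣q∸1 q∸1∣N∸1)
  ... | ζ , ζ≉1 , ζ^g≈1 = ζ , 𝔽q-ζ , ζ≉1 , ζ^g≈1
    where
    𝔽q-ζ : 𝔽q ζ
    𝔽q-ζ = begin
      ζ ^ q                 ≡⟨ ≡.cong (ζ ^_) (≡.trans q≡1+[q∸1] (≡.cong suc q∸1≡k*g)) ⟩
      ζ * ζ ^ (k ℕ.* g)     ≈⟨ *-congˡ (^[k*n]≈1 k ζ^g≈1) ⟩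
      ζ * 1#                ≈⟨ *-identityʳ ζ ⟩
      ζ                     ∎

module F6 {c ℓ} (F : CommutativeRing c ℓ) {p m : ℕ} (p-prime : Prime p) (1≤m : 1 ℕ.≤ m)
  (F-finite : IsFiniteField F (p ℕ.^ (3 ℕ.* m))) (a : CommutativeRing.Carrier F)
  (a-norm : CommutativeRing._≈_ F (pow F a (p ℕ.^ m ℕ.* p ℕ.^ m ℕ.+ p ℕ.^ m ℕ.+ 1)) (CommutativeRing.1# F)) where

  open CommutativeRing F hiding (zero)
  open CubicExtension F p-prime 1≤m F-finite
  open RootsOfUnity F using (1^n≈1; ^[k*n]≈1)
  open import Algebra.Properties.Semiring.Exp semiring using (_^_; ^-congˡ; ^-assocʳ; ^-homo-*)
  open import Algebra.Properties.Ring ring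
    using (-0#≈0#; -‿involutive; -‿distribʳ-*; +-inverseˡ-unique; +-inverseʳ-unique; +-cancelʳ; x∙y⁻¹≈ε⇒x≈y; x≈y⇒x∙y⁻¹≈ε)
  open import Relation.Binary.Reasoning.Setoid setoid
  open IntegerCoefficientSolver F

  2# : Carrier
  2# = 1# + 1#

  a₁ a₂ : Carrier
  a₁ = φ a
  a₂ = φ a₁

  φa₂≈a : φ a₂ ≈ a
  φa₂≈a = φ³≈id a

  norm : a * a₁ * a₂ ≈ 1#
  norm = begin
    a * a₁ * a₂                       ≈⟨ solve 3 (λ x y z → x :* y :* z := z :* y :* (x :* con (+ 1))) refl a a₁ a₂ ⟩
    a₂ * a₁ * (a * 1#)                ≈⟨ *-congʳ (*-congʳ (^-assocʳ a q q)) ⟩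
    a ^ (q ℕ.* q) * a ^ q * a ^ 1     ≈⟨ *-congʳ (sym (^-homo-* a (q ℕ.* q) q)) ⟩
    a ^ (q ℕ.* q ℕ.+ q) * a ^ 1       ≈⟨ sym (^-homo-* a (q ℕ.* q ℕ.+ q) 1) ⟩
    a ^ (q ℕ.* q ℕ.+ q ℕ.+ 1)         ≈⟨ a-norm ⟩
    1#                                ∎

  -- Identities holding only modulo the norm relation are proved by exhibiting the multiple of a a₁ a₂ - 1.
  by-norm : ∀ {x y} r → x ≈ y + (a * a₁ * a₂ - 1#) * r → x ≈ y
  by-norm {x} {y} r x≈ = trans x≈ (trans (+-congˡ (trans (*-congʳ (trans (+-congʳ norm) (-‿inverseʳ 1#))) (zeroˡ r))) (+-identityʳ y))

  c₀ c₁ c₂ : Carrier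
  c₀ = a + a₁ * a₂ - 2#
  c₁ = a₁ + a₂ * a - 2#
  c₂ = a₂ + a * a₁ - 2#

  φ-c : ∀ x y z → φ (x + y * z - 2#) ≈ φ x + φ y * φ z - 2#
  φ-c x y z = trans (φ-sub _ _) (+-cong (trans (φ-+ _ _) (+-congˡ (φ-* y z))) (-‿cong 𝔽q-2))

  φc₀ : φ c₀ ≈ c₁
  φc₀ = trans (φ-c a a₁ a₂) (+-congʳ (+-congˡ (*-congˡ φa₂≈a)))

  φc₁ : φ c₁ ≈ c₂
  φc₁ = trans (φ-c a₁ a₂ a) (+-congʳ (+-congˡ (*-congʳ φa₂≈a)))

  φc₂ : φ c₂ ≈ c₀
  φc₂ = trans (φ-c a₂ a a₁) (+-congʳ (+-congʳ φa₂≈a))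

  φφc₀ : φ (φ c₀) ≈ c₂
  φφc₀ = trans (φ-cong φc₀) φc₁

  φφc₂ : φ (φ c₂) ≈ c₁
  φφc₂ = trans (φ-cong φc₂) φc₀

  φφ-* : ∀ x y → φ (φ (x * y)) ≈ φ (φ x) * φ (φ y)
  φφ-* x y = trans (φ-cong (φ-* x y)) (φ-* _ _)

  M : Carrier → Carrier
  M x = c₀ * φ x + c₁ * x

  L : Carrier → Carrier
  L x = M x + 2# * T x

  f6≈L+T^s : ∀ s x → f6 F q s a x ≈ L x + T x ^ s
  f6≈L+T^s s x = begin
    2# * x ^ (q ℕ.* q) + (a + a ^ (q ℕ.+ q ℕ.* q)) * x ^ q + (a ^ (1 ℕ.+ q ℕ.* q) + a ^ q) * x + Tr F q x ^ s
      ≈⟨ +-cong (+-cong (+-cong (*-congˡ (sym (^-assocʳ x q q)))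
                               (*-congʳ (+-congˡ (trans (^-homo-* a q (q ℕ.* q)) (*-congˡ (sym (^-assocʳ a q q)))))))
                        (*-congʳ (+-congʳ (trans (^-homo-* a 1 (q ℕ.* q)) (*-congˡ (sym (^-assocʳ a q q)))))))
                (^-congˡ s (Tr≈T x)) ⟩
    2# * φ (φ x) + (a + a₁ * a₂) * φ x + (a * 1# * a₂ + a₁) * x + T x ^ s
      ≈⟨ +-congʳ (solve 6 (λ x₀ x₁ x₂ b₀ b₁ b₂ →
           con (+ 2) :* x₂ :+ (b₀ :+ b₁ :* b₂) :* x₁ :+ (b₀ :* con (+ 1) :* b₂ :+ b₁) :* x₀
           := ((b₀ :+ b₁ :* b₂) :- con (+ 2)) :* x₁ :+ ((b₁ :+ b₂ :* b₀) :- con (+ 2)) :* x₀ :+ con (+ 2) :* (x₀ :+ x₁ :+ x₂))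
           refl x (φ x) (φ (φ x)) a a₁ a₂) ⟩
    L x + T x ^ s ∎

  M-cong : ∀ {x y} → x ≈ y → M x ≈ M y
  M-cong x≈y = +-cong (*-congˡ (φ-cong x≈y)) (*-congˡ x≈y)

  L-cong : ∀ {x y} → x ≈ y → L x ≈ L y
  L-cong x≈y = +-cong (M-cong x≈y) (*-congˡ (T-cong x≈y))

  M-sub : ∀ x y → M (x - y) ≈ M x - M y
  M-sub x y = begin
    c₀ * φ (x - y) + c₁ * (x - y)    ≈⟨ +-congʳ (*-congˡ (φ-sub x y)) ⟩
    c₀ * (φ x - φ y) + c₁ * (x - y)
      ≈⟨ solve 6 (λ c d u v x y → c :* (u :- v) :+ d :* (x :- y) := (c :* u :+ d :* x) :- (c :* v :+ d :* y))
                 refl c₀ c₁ (φ x) (φ y) x y ⟩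
    M x - M y                        ∎

  L-+ : ∀ x y → L (x + y) ≈ L x + L y
  L-+ x y = begin
    c₀ * φ (x + y) + c₁ * (x + y) + 2# * T (x + y)  ≈⟨ +-cong (+-congʳ (*-congˡ (φ-+ x y))) (*-congˡ (T-+ x y)) ⟩
    c₀ * (φ x + φ y) + c₁ * (x + y) + 2# * (T x + T y)
      ≈⟨ solve 8 (λ c d u v x y s t → c :* (u :+ v) :+ d :* (x :+ y) :+ con (+ 2) :* (s :+ t)
                  := (c :* u :+ d :* x :+ con (+ 2) :* s) :+ (c :* v :+ d :* y :+ con (+ 2) :* t))
                 refl c₀ c₁ (φ x) (φ y) x y (T x) (T y) ⟩
    L x + L y ∎

  L-sub : ∀ x y → L (x - y) ≈ L x - L y
  L-sub x y = begin
    c₀ * φ (x - y) + c₁ * (x - y) + 2# * T (x - y)  ≈⟨ +-cong (+-congʳ (*-congˡ (φ-sub x y))) (*-congˡ (T-sub x y)) ⟩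
    c₀ * (φ x - φ y) + c₁ * (x - y) + 2# * (T x - T y)
      ≈⟨ solve 8 (λ c d u v x y s t → c :* (u :- v) :+ d :* (x :- y) :+ con (+ 2) :* (s :- t)
                  := (c :* u :+ d :* x :+ con (+ 2) :* s) :- (c :* v :+ d :* y :+ con (+ 2) :* t))
                 refl c₀ c₁ (φ x) (φ y) x y (T x) (T y) ⟩
    L x - L y ∎

  L-scale : ∀ {u} x → 𝔽q u → L (u * x) ≈ u * L x
  L-scale {u} x φu≈u = begin
    c₀ * φ (u * x) + c₁ * (u * x) + 2# * T (u * x)
      ≈⟨ +-cong (+-congʳ (*-congˡ (trans (φ-* u x) (*-congʳ φu≈u)))) (*-congˡ (T-scale x φu≈u)) ⟩
    c₀ * (u * φ x) + c₁ * (u * x) + 2# * (u * T x)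
      ≈⟨ solve 6 (λ c d u v x t → c :* (u :* v) :+ d :* (u :* x) :+ con (+ 2) :* (u :* t)
                  := u :* (c :* v :+ d :* x :+ con (+ 2) :* t)) refl c₀ c₁ u (φ x) x (T x) ⟩
    u * L x ∎

  T-*M : ∀ w z → T (w * M z) ≈ T ((φ (φ (w * c₀)) + w * c₁) * z)
  T-*M w z = begin
    T (w * (c₀ * φ z + c₁ * z))
      ≈⟨ T-cong (solve 5 (λ w c d x y → w :* (c :* x :+ d :* y) := (w :* c) :* x :+ (w :* d) :* y) refl w c₀ c₁ (φ z) z) ⟩
    T ((w * c₀) * φ z + (w * c₁) * z)           ≈⟨ T-+ _ _ ⟩
    T ((w * c₀) * φ z) + T ((w * c₁) * z)       ≈⟨ +-congʳ (T-adjoint _ _) ⟩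
    T (φ (φ (w * c₀)) * z) + T ((w * c₁) * z)   ≈⟨ sym (T-+ _ _) ⟩
    T (φ (φ (w * c₀)) * z + (w * c₁) * z)       ≈⟨ T-cong (sym (distribʳ z _ _)) ⟩
    T ((φ (φ (w * c₀)) + w * c₁) * z)           ∎

  a≈1⇒M≈0 : a ≈ 1# → ∀ x → M x ≈ 0#
  a≈1⇒M≈0 a≈1 x = begin
    c₀ * φ x + c₁ * x  ≈⟨ +-cong (*-congʳ c₀≈0) (*-congʳ (trans (sym φc₀) (trans (φ-cong c₀≈0) φ-0))) ⟩
    0# * φ x + 0# * x  ≈⟨ trans (+-cong (zeroˡ _) (zeroˡ _)) (+-identityʳ 0#) ⟩
    0#                 ∎
    where
    a₁≈1 : a₁ ≈ 1#
    a₁≈1 = trans (φ-cong a≈1) φ-1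
    c₀≈0 : c₀ ≈ 0#
    c₀≈0 = begin
      a + a₁ * a₂ - 2#    ≈⟨ +-congʳ (+-cong a≈1 (*-cong a₁≈1 (trans (φ-cong a₁≈1) φ-1))) ⟩
      1# + 1# * 1# - 2#   ≈⟨ solve 0 (con (+ 1) :+ con (+ 1) :* con (+ 1) :- con (+ 2) := con (+ 0)) refl ⟩
      0#                  ∎

  c₀*a≈[a-1]² : c₀ * a ≈ (a - 1#) * (a - 1#)
  c₀*a≈[a-1]² = by-norm 1# (solve 3 (λ x y z →
    (x :+ y :* z :- con (+ 2)) :* x := (x :- con (+ 1)) :* (x :- con (+ 1)) :+ (x :* y :* z :- con (+ 1)) :* con (+ 1))
    refl a a₁ a₂)

  c₀c₁c₂ : Carrier
  c₀c₁c₂ = c₀ * c₁ * c₂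

  𝔽q-c₀c₁c₂ : 𝔽q c₀c₁c₂
  𝔽q-c₀c₁c₂ = begin
    φ (c₀ * c₁ * c₂)   ≈⟨ trans (φ-* _ _) (*-cong (φ-* _ _) φc₂) ⟩
    φ c₀ * φ c₁ * c₀   ≈⟨ *-congʳ (*-cong φc₀ φc₁) ⟩
    c₁ * c₂ * c₀       ≈⟨ solve 3 (λ x y z → y :* z :* x := x :* y :* z) refl c₀ c₁ c₂ ⟩
    c₀ * c₁ * c₂       ∎

  c₂*M : ∀ z → z * c₁ * c₂ + φ (z * c₁ * c₂) ≈ c₂ * M z
  c₂*M z = begin
    z * c₁ * c₂ + φ (z * c₁ * c₂)  ≈⟨ +-congˡ (trans (φ-* _ _) (*-cong (trans (φ-* _ _) (*-congˡ φc₁)) φc₂)) ⟩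
    z * c₁ * c₂ + φ z * c₂ * c₀    ≈⟨ solve 5 (λ z w a b c → z :* b :* c :+ w :* c :* a := c :* (a :* w :+ b :* z)) refl z (φ z) c₀ c₁ c₂ ⟩
    c₂ * M z                       ∎

  c₀≉0 : a ≉ 1# → c₀ ≉ 0#
  c₀≉0 a≉1 c₀≈0 = a≉1 (x∙y⁻¹≈ε⇒x≈y a 1# (x*x≈0⇒x≈0 (trans (sym c₀*a≈[a-1]²) (trans (*-congʳ c₀≈0) (zeroˡ a)))))

  c₁≉0 : a ≉ 1# → c₁ ≉ 0#
  c₁≉0 a≉1 c₁≈0 = φ-≉0 (c₀≉0 a≉1) (trans φc₀ c₁≈0)

  c₂≉0 : a ≉ 1# → c₂ ≉ 0#
  c₂≉0 a≉1 c₂≈0 = φ-≉0 (c₁≉0 a≉1) (trans φc₁ c₂≈0)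

  c₀c₁c₂≉0 : a ≉ 1# → c₀c₁c₂ ≉ 0#
  c₀c₁c₂≉0 a≉1 = x*y≉0 (x*y≉0 (c₀≉0 a≉1) (c₁≉0 a≉1)) (c₂≉0 a≉1)

  module OddCharacteristic (a≉1 : a ≉ 1#) (2≉0 : 2# ≉ 0#) where

    γ : Carrier
    γ = (c₀ + c₁ - c₂) * c₂

    φ-γ-shape : ∀ x y z w → φ ((x + y - z) * w) ≈ (φ x + φ y - φ z) * φ w
    φ-γ-shape x y z w = trans (φ-* _ _) (*-congʳ (trans (φ-sub _ _) (+-congʳ (φ-+ x y))))

    φγ : φ γ ≈ (c₁ + c₂ - c₀) * c₀
    φγ = trans (φ-γ-shape c₀ c₁ c₂ c₂) (*-cong (+-cong (+-cong φc₀ φc₁) (-‿cong φc₂)) φc₂)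

    φφγ : φ (φ γ) ≈ (c₂ + c₀ - c₁) * c₁
    φφγ = trans (φ-cong φγ) (trans (φ-γ-shape c₁ c₂ c₀ c₀) (*-cong (+-cong (+-cong φc₁ φc₂) (-‿cong φc₀)) φc₀))

    T-γ*M : ∀ z → T (γ * M z) ≈ 2# * c₀c₁c₂ * T z
    T-γ*M z = begin
      T (γ * M z)                                   ≈⟨ T-*M γ z ⟩
      T ((φ (φ (γ * c₀)) + γ * c₁) * z)             ≈⟨ T-cong (*-congʳ (+-congʳ (trans (φφ-* γ c₀) (*-cong φφγ φφc₀)))) ⟩
      T (((c₂ + c₀ - c₁) * c₁ * c₂ + γ * c₁) * z)
        ≈⟨ T-cong (*-congʳ (solve 3 (λ x y z → (z :+ x :- y) :* y :* z :+ ((x :+ y :- z) :* z) :* y := con (+ 2) :* (x :* y :* z)) refl c₀ c₁ c₂)) ⟩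
      T ((2# * c₀c₁c₂) * z)                         ≈⟨ T-scale z (𝔽q-* 𝔽q-2 𝔽q-c₀c₁c₂) ⟩
      2# * c₀c₁c₂ * T z                             ∎


    T-γ : T γ ≈ - c₀c₁c₂
    T-γ = begin
      γ + φ γ + φ (φ γ)   ≈⟨ +-cong (+-congˡ φγ) φφγ ⟩
      (c₀ + c₁ - c₂) * c₂ + (c₁ + c₂ - c₀) * c₀ + (c₂ + c₀ - c₁) * c₁
        ≈⟨ by-norm (a * a + a₁ * a₁ + a₂ * a₂ + a * a₁ * a₂ - 4#) (solve 3 (λ x y z →
             let d₀ = x :+ y :* z :- con (+ 2) ; d₁ = y :+ z :* x :- con (+ 2) ; d₂ = z :+ x :* y :- con (+ 2) in
             (d₀ :+ d₁ :- d₂) :* d₂ :+ (d₁ :+ d₂ :- d₀) :* d₀ :+ (d₂ :+ d₀ :- d₁) :* d₁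
             := :- (d₀ :* d₁ :* d₂) :+ (x :* y :* z :- con (+ 1)) :* (x :* x :+ y :* y :+ z :* z :+ x :* y :* z :- con (+ 4)))
             refl a a₁ a₂) ⟩
      - c₀c₁c₂            ∎
      where
      4# = 1# + 1# + 1# + 1#

    M-injective : ∀ {z} → M z ≈ 0# → z ≈ 0#
    M-injective {z} Mz≈0 = x*y≈0∧y≉0⇒x≈0 (x*y≈0∧y≉0⇒x≈0 w≈0 (c₂≉0 a≉1)) (c₁≉0 a≉1)
      where
      w = z * c₁ * c₂
      conjugate-sum≈0 : ∀ {v} → v + φ v ≈ 0# → φ v + φ (φ v) ≈ 0#
      conjugate-sum≈0 v+φv≈0 = trans (sym (φ-+ _ _)) (trans (φ-cong v+φv≈0) φ-0)
      w+φw≈0 : w + φ w ≈ 0#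
      w+φw≈0 = trans (c₂*M z) (trans (*-congˡ Mz≈0) (zeroʳ c₂))
      φw+φφw≈0 = conjugate-sum≈0 w+φw≈0
      φφw+w≈0 : φ (φ w) + w ≈ 0#
      φφw+w≈0 = trans (+-congˡ (sym (φ³≈id w))) (conjugate-sum≈0 φw+φφw≈0)
      -- w = -φ w = φ² w = -w, since φ³ = id
      w≈0 : w ≈ 0#
      w≈0 = x*y≈0∧x≉0⇒y≈0 (begin
        2# * w
          ≈⟨ solve 3 (λ a b c → con (+ 2) :* a := (a :+ b) :- (b :+ c) :+ (c :+ a)) refl w (φ w) (φ (φ w)) ⟩
        (w + φ w) - (φ w + φ (φ w)) + (φ (φ w) + w)           ≈⟨ +-cong (+-cong w+φw≈0 (-‿cong φw+φφw≈0)) φφw+w≈0 ⟩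
        0# - 0# + 0#                                          ≈⟨ trans (+-identityʳ _) (-‿inverseʳ 0#) ⟩
        0#                                                    ∎) 2≉0

    annihilates-L : ∀ z → T (γ * L z) ≈ 0#
    annihilates-L z = begin
      T (γ * (M z + 2# * T z))                      ≈⟨ T-cong (distribˡ γ _ _) ⟩
      T (γ * M z + γ * (2# * T z))                  ≈⟨ T-+ _ _ ⟩
      T (γ * M z) + T (γ * (2# * T z))              ≈⟨ +-cong (T-γ*M z) (trans (T-cong (*-comm _ _)) (T-scale γ (𝔽q-* 𝔽q-2 (T∈𝔽q z)))) ⟩
      2# * c₀c₁c₂ * T z + 2# * T z * T γ            ≈⟨ +-congˡ (*-congˡ T-γ) ⟩
      2# * c₀c₁c₂ * T z + 2# * T z * - c₀c₁c₂
        ≈⟨ solve 2 (λ n t → con (+ 2) :* n :* t :+ con (+ 2) :* t :* (:- n) := con (+ 0)) refl c₀c₁c₂ (T z) ⟩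
      0#                                            ∎

    T-γ≉0 : T γ ≉ 0#
    T-γ≉0 T-γ≈0 = c₀c₁c₂≉0 a≉1 (trans (sym (-‿involutive c₀c₁c₂)) (trans (-‿cong (trans (sym T-γ) T-γ≈0)) -0#≈0#))

    ∃-kernel-element : ∃ λ d → L d ≈ 0# × T d ≉ 0#
    ∃-kernel-element = x₀ + z₀ , L-d≈0 , T-d≉0
      where
      x₀ = proj₁ ∃-T≉0
      M-surjective : Surjective _≈_ _≈_ M
      M-surjective = injective⇒surjective M-cong
        (λ Mx≈My → x∙y⁻¹≈ε⇒x≈y _ _ (M-injective (trans (M-sub _ _) (x≈y⇒x∙y⁻¹≈ε Mx≈My))))
      z₀ = proj₁ (M-surjective (- L x₀))
      M-z₀ : M z₀ ≈ - L x₀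
      M-z₀ = proj₂ (M-surjective (- L x₀)) refl
      T-z₀≈0 : T z₀ ≈ 0#
      T-z₀≈0 = x*y≈0∧x≉0⇒y≈0 (begin
        2# * c₀c₁c₂ * T z₀   ≈⟨ sym (T-γ*M z₀) ⟩
        T (γ * M z₀)         ≈⟨ T-cong (trans (*-congˡ M-z₀) (sym (-‿distribʳ-* γ _))) ⟩
        T (- (γ * L x₀))     ≈⟨ T-neg _ ⟩
        - T (γ * L x₀)       ≈⟨ trans (-‿cong (annihilates-L x₀)) -0#≈0# ⟩
        0#                   ∎) (x*y≉0 2≉0 (c₀c₁c₂≉0 a≉1))
      L-d≈0 : L (x₀ + z₀) ≈ 0#
      L-d≈0 = begin
        L (x₀ + z₀)                   ≈⟨ L-+ x₀ z₀ ⟩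
        L x₀ + (M z₀ + 2# * T z₀)     ≈⟨ +-congˡ (+-cong M-z₀ (trans (*-congˡ T-z₀≈0) (zeroʳ 2#))) ⟩
        L x₀ + (- L x₀ + 0#)          ≈⟨ trans (+-congˡ (+-identityʳ _)) (-‿inverseʳ _) ⟩
        0#                            ∎
      T-d≉0 : T (x₀ + z₀) ≉ 0#
      T-d≉0 T-d≈0 = proj₂ ∃-T≉0 (trans (sym (+-identityʳ _)) (trans (+-congˡ (sym T-z₀≈0)) (trans (sym (T-+ x₀ z₀)) T-d≈0)))

  module EvenCharacteristic (a≉1 : a ≉ 1#) (2≈0 : 2# ≈ 0#) where

    -x≈x : ∀ x → - x ≈ x
    -x≈x x = sym (+-inverseˡ-unique x x (trans (sym (trans (distribʳ x 1# 1#) (+-cong (*-identityˡ x) (*-identityˡ x)))) (trans (*-congʳ 2≈0) (zeroˡ x))))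

    2*x≈0 : ∀ x → 2# * x ≈ 0#
    2*x≈0 x = trans (*-congʳ 2≈0) (zeroˡ x)

    T-c₂*M : ∀ z → T (c₂ * M z) ≈ 0#
    T-c₂*M z = begin
      T (c₂ * M z)                         ≈⟨ T-*M c₂ z ⟩
      T ((φ (φ (c₂ * c₀)) + c₂ * c₁) * z)  ≈⟨ T-cong (*-congʳ (+-congʳ (trans (φφ-* c₂ c₀) (*-cong φφc₂ φφc₀)))) ⟩
      T ((c₁ * c₂ + c₂ * c₁) * z)          ≈⟨ T-cong (*-congʳ (solve 2 (λ x y → x :* y :+ y :* x := con (+ 2) :* (x :* y)) refl c₁ c₂)) ⟩
      T ((2# * (c₁ * c₂)) * z)             ≈⟨ T-cong (trans (*-congʳ (2*x≈0 _)) (zeroˡ z)) ⟩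
      T 0#                                 ≈⟨ T-0 ⟩
      0#                                   ∎

    T-c₀ : T c₀ ≈ (1# + a) * (1# + a₁) * (1# + a₂)
    T-c₀ = begin
      c₀ + φ c₀ + φ (φ c₀)  ≈⟨ +-cong (+-congˡ φc₀) φφc₀ ⟩
      c₀ + c₁ + c₂
        ≈⟨ by-norm (- 1#) (solve 3 (λ x y z →
             (x :+ y :* z :- con (+ 2)) :+ (y :+ z :* x :- con (+ 2)) :+ (z :+ x :* y :- con (+ 2))
             := (con (+ 1) :+ x) :* (con (+ 1) :+ y) :* (con (+ 1) :+ z) :- con (+ 4) :* con (+ 2)
                :+ (x :* y :* z :- con (+ 1)) :* (:- con (+ 1)))
             refl a a₁ a₂) ⟩
      (1# + a) * (1# + a₁) * (1# + a₂) - 4# * 2#  ≈⟨ +-congˡ (trans (-‿cong (trans (*-congˡ 2≈0) (zeroʳ 4#))) -0#≈0#) ⟩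
      (1# + a) * (1# + a₁) * (1# + a₂) + 0#       ≈⟨ +-identityʳ _ ⟩
      (1# + a) * (1# + a₁) * (1# + a₂)            ∎
      where
      4# = 1# + 1# + 1# + 1#

    T-c₀≉0 : T c₀ ≉ 0#
    T-c₀≉0 T-c₀≈0 = x*y≉0 (x*y≉0 1+a≉0 1+a₁≉0) 1+a₂≉0 (trans (sym T-c₀) T-c₀≈0)
      where
      φ-1+ : ∀ x → φ (1# + x) ≈ 1# + φ x
      φ-1+ x = trans (φ-+ 1# x) (+-congʳ φ-1)
      1+a≉0 : 1# + a ≉ 0#
      1+a≉0 1+a≈0 = a≉1 (trans (+-inverseʳ-unique 1# a 1+a≈0) (-x≈x 1#))
      1+a₁≉0 : 1# + a₁ ≉ 0#
      1+a₁≉0 1+a₁≈0 = φ-≉0 1+a≉0 (trans (φ-1+ a) 1+a₁≈0)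
      1+a₂≉0 : 1# + a₂ ≉ 0#
      1+a₂≉0 1+a₂≈0 = φ-≉0 1+a₁≉0 (trans (φ-1+ a₁) 1+a₂≈0)

    T-c₂≈T-c₀ : T c₂ ≈ T c₀
    T-c₂≈T-c₀ = trans (T-cong (sym φφc₀)) (trans (T-φ _) (T-φ c₀))

    kernel : ∀ {d} → M d ≈ 0# → T d ≈ 0# → d ≈ 0#
    kernel {d} Md≈0 Td≈0 = x*y≈0∧y≉0⇒x≈0 (x*y≈0∧y≉0⇒x≈0 (x*y≈0∧y≉0⇒x≈0 w*T-c₀≈0 T-c₀≉0) (c₂≉0 a≉1)) (c₁≉0 a≉1)
      where
      w = d * c₁ * c₂
      w+φw≈0 : w + φ w ≈ 0#
      w+φw≈0 = trans (c₂*M d) (trans (*-congˡ Md≈0) (zeroʳ c₂))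
      𝔽q-w : 𝔽q w
      𝔽q-w = trans (+-inverseʳ-unique w (φ w) w+φw≈0) (-x≈x w)
      w*T-c₀≈0 : w * T c₀ ≈ 0#
      w*T-c₀≈0 = begin
        w * T c₀          ≈⟨ sym (T-scale c₀ 𝔽q-w) ⟩
        T (w * c₀)        ≈⟨ T-cong (solve 4 (λ d x y z → d :* y :* z :* x := x :* y :* z :* d) refl d c₀ c₁ c₂) ⟩
        T (c₀c₁c₂ * d)    ≈⟨ T-scale d 𝔽q-c₀c₁c₂ ⟩
        c₀c₁c₂ * T d      ≈⟨ trans (*-congˡ Td≈0) (zeroʳ _) ⟩
        0#                ∎

    annihilates-L : ∀ z → T (c₂ * L z) ≈ 0#
    annihilates-L z = begin
      T (c₂ * (M z + 2# * T z))            ≈⟨ T-cong (trans (distribˡ c₂ _ _) (+-congˡ (trans (*-congˡ (2*x≈0 _)) (zeroʳ c₂)))) ⟩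
      T (c₂ * M z + 0#)                    ≈⟨ T-cong (+-identityʳ _) ⟩
      T (c₂ * M z)                         ≈⟨ T-c₂*M z ⟩
      0#                                   ∎

    T-c₂≉0 : T c₂ ≉ 0#
    T-c₂≉0 T-c₂≈0 = T-c₀≉0 (trans (sym T-c₂≈T-c₀) T-c₂≈0)

    L-c₀≈0 : L c₀ ≈ 0#
    L-c₀≈0 = begin
      c₀ * φ c₀ + c₁ * c₀ + 2# * T c₀  ≈⟨ +-cong (+-congʳ (*-congˡ φc₀)) (2*x≈0 _) ⟩
      c₀ * c₁ + c₁ * c₀ + 0#           ≈⟨ trans (+-identityʳ _) (solve 2 (λ x y → x :* y :+ y :* x := con (+ 2) :* (x :* y)) refl c₀ c₁) ⟩
      2# * (c₀ * c₁)                   ≈⟨ 2*x≈0 _ ⟩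
      0#                               ∎

  kernel-trivial : a ≉ 1# → ∀ {d} → L d ≈ 0# → T d ≈ 0# → d ≈ 0#
  kernel-trivial a≉1 {d} Ld≈0 Td≈0 = by-characteristic (2# ≟ 0#)
    where
    Md≈0 : M d ≈ 0#
    Md≈0 = trans (sym (+-identityʳ _)) (trans (+-congˡ (sym (trans (*-congˡ Td≈0) (zeroʳ 2#)))) Ld≈0)
    by-characteristic : Dec (2# ≈ 0#) → d ≈ 0#
    by-characteristic (yes 2≈0) = EvenCharacteristic.kernel a≉1 2≈0 Md≈0 Td≈0
    by-characteristic (no 2≉0) = OddCharacteristic.M-injective a≉1 2≉0 Md≈0

  ∃-annihilator : a ≉ 1# → ∃ λ β → T β ≉ 0# × (∀ z → T (β * L z) ≈ 0#)
  ∃-annihilator a≉1 with 2# ≟ 0#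
  ... | yes 2≈0 = c₂ , T-c₂≉0 , annihilates-L
    where open EvenCharacteristic a≉1 2≈0
  ... | no 2≉0 = γ , T-γ≉0 , annihilates-L
    where open OddCharacteristic a≉1 2≉0

  ∃-kernel-element : a ≉ 1# → ∃ λ e → L e ≈ 0# × T e ≈ 1#
  ∃-kernel-element a≉1 = t⁻¹ * d , L-e≈0 , T-e≈1
    where
    unnormalised : ∃ λ d → L d ≈ 0# × T d ≉ 0#
    unnormalised with 2# ≟ 0#
    ... | yes 2≈0 = c₀ , L-c₀≈0 , T-c₀≉0
      where open EvenCharacteristic a≉1 2≈0
    ... | no 2≉0 = OddCharacteristic.∃-kernel-element a≉1 2≉0
    d = proj₁ unnormalised
    t⁻¹ = proj₁ (IsFiniteField.inverse F-finite (T d) (proj₂ (proj₂ unnormalised)))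
    t*t⁻¹≈1 : T d * t⁻¹ ≈ 1#
    t*t⁻¹≈1 = proj₂ (IsFiniteField.inverse F-finite (T d) (proj₂ (proj₂ unnormalised)))
    𝔽q-t⁻¹ : 𝔽q t⁻¹
    𝔽q-t⁻¹ = 𝔽q-inverse (T∈𝔽q d) t*t⁻¹≈1
    L-e≈0 : L (t⁻¹ * d) ≈ 0#
    L-e≈0 = trans (L-scale d 𝔽q-t⁻¹) (trans (*-congˡ (proj₁ (proj₂ unnormalised))) (zeroʳ t⁻¹))
    T-e≈1 : T (t⁻¹ * d) ≈ 1#
    T-e≈1 = trans (T-scale d 𝔽q-t⁻¹) (trans (*-comm _ _) t*t⁻¹≈1)

  f6-cong : ∀ s {x y} → x ≈ y → f6 F q s a x ≈ f6 F q s a y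
  f6-cong s {x} {y} x≈y = trans (f6≈L+T^s s x) (trans (+-cong (L-cong x≈y) (^-congˡ s (T-cong x≈y))) (sym (f6≈L+T^s s y)))

  f6-injective : a ≉ 1# → ∀ s → 1 ℕ.≤ s → gcd s (q ℕ.∸ 1) ≡ 1 → Injective _≈_ _≈_ (f6 F q s a)
  f6-injective a≉1 s 1≤s gcd≡1 {x} {y} fx≈fy =
    x∙y⁻¹≈ε⇒x≈y x y (kernel-trivial a≉1 (trans (L-sub x y) (x≈y⇒x∙y⁻¹≈ε Lx≈Ly)) (trans (T-sub x y) (x≈y⇒x∙y⁻¹≈ε Tx≈Ty)))
    where
    β = proj₁ (∃-annihilator a≉1)
    T-β≉0 = proj₁ (proj₂ (∃-annihilator a≉1))
    T-β*f : ∀ z → T (β * f6 F q s a z) ≈ T β * T z ^ s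
    T-β*f z = begin
      T (β * f6 F q s a z)             ≈⟨ T-cong (trans (*-congˡ (f6≈L+T^s s z)) (distribˡ β _ _)) ⟩
      T (β * L z + β * T z ^ s)        ≈⟨ T-+ _ _ ⟩
      T (β * L z) + T (β * T z ^ s)
        ≈⟨ +-cong (proj₂ (proj₂ (∃-annihilator a≉1)) z) (trans (T-cong (*-comm _ _)) (T-scale β (𝔽q-^ s (T∈𝔽q z)))) ⟩
      0# + T z ^ s * T β               ≈⟨ trans (+-identityˡ _) (*-comm _ _) ⟩
      T β * T z ^ s                    ∎
    Tx≈Ty : T x ≈ T y
    Tx≈Ty = 𝔽q-^-injective 1≤s gcd≡1 (T∈𝔽q x) (T∈𝔽q y)
      (*-cancelˡ T-β≉0 (trans (sym (T-β*f x)) (trans (T-cong (*-congˡ fx≈fy)) (T-β*f y))))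
    Lx≈Ly : L x ≈ L y
    Lx≈Ly = +-cancelʳ (T x ^ s) (L x) (L y)
      (trans (sym (f6≈L+T^s s x)) (trans fx≈fy (trans (f6≈L+T^s s y) (+-congˡ (^-congˡ s (sym Tx≈Ty))))))

  a≈1⇒f6-not-injective : a ≈ 1# → ∀ s → ¬ Injective _≈_ _≈_ (f6 F q s a)
  a≈1⇒f6-not-injective a≈1 s f-injective = proj₂ ∃-non-fixed (f-injective (begin
    f6 F q s a z                ≈⟨ f6≈L+T^s s z ⟩
    M z + 2# * T z + T z ^ s    ≈⟨ +-cong (+-cong (trans (a≈1⇒M≈0 a≈1 z) (sym (a≈1⇒M≈0 a≈1 0#))) (*-congˡ T-z≈T-0)) (^-congˡ s T-z≈T-0) ⟩
    M 0# + 2# * T 0# + T 0# ^ s ≈⟨ sym (f6≈L+T^s s 0#) ⟩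
    f6 F q s a 0#               ∎))
    where
    ω = proj₁ ∃-non-fixed
    z = φ ω - ω
    T-z≈T-0 : T z ≈ T 0#
    T-z≈T-0 = trans (T-sub (φ ω) ω) (trans (x≈y⇒x∙y⁻¹≈ε (T-φ ω)) (sym T-0))

  gcd≢1⇒f6-not-injective : a ≉ 1# → ∀ s → gcd s (q ℕ.∸ 1) ≢ 1 → ¬ Injective _≈_ _≈_ (f6 F q s a)
  gcd≢1⇒f6-not-injective a≉1 s gcd≢1 f-injective = ζ≉1 (begin
    ζ                 ≈⟨ sym (*-identityʳ ζ) ⟩
    ζ * 1#            ≈⟨ *-congˡ (sym T-e≈1) ⟩
    ζ * T e           ≈⟨ sym (T-scale e 𝔽q-ζ) ⟩
    T (ζ * e)         ≈⟨ T-cong (f-injective f6[ζ*e]≈f6[1*e]) ⟩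
    T (1# * e)        ≈⟨ T-cong (*-identityˡ e) ⟩
    T e               ≈⟨ T-e≈1 ⟩
    1#                ∎)
    where
    g = gcd s (q ℕ.∸ 1)
    1<g : 1 ℕ.< g
    1<g = ℕP.≤∧≢⇒< (ℕP.n≢0⇒n>0 (ℕP.m>n⇒m∸n≢0 1<q ∘ gcd[m,n]≡0⇒n≡0 s)) (gcd≢1 ∘ ≡.sym)
    root = ∃-𝔽q-root-of-unity 1<g (gcd[m,n]∣n s (q ℕ.∸ 1))
    ζ = proj₁ root
    𝔽q-ζ = proj₁ (proj₂ root)
    ζ≉1 = proj₁ (proj₂ (proj₂ root))
    ζ^s≈1 : ζ ^ s ≈ 1#
    ζ^s≈1 with gcd[m,n]∣m s (q ℕ.∸ 1)
    ... | divides j s≡j*g = trans (reflexive (≡.cong (ζ ^_) s≡j*g)) (^[k*n]≈1 j (proj₂ (proj₂ (proj₂ root))))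
    e = proj₁ (∃-kernel-element a≉1)
    L-e≈0 = proj₁ (proj₂ (∃-kernel-element a≉1))
    T-e≈1 = proj₂ (proj₂ (∃-kernel-element a≉1))
    f6[t*e]≈t^s : ∀ {t} → 𝔽q t → f6 F q s a (t * e) ≈ t ^ s
    f6[t*e]≈t^s {t} 𝔽q-t = begin
      f6 F q s a (t * e)       ≈⟨ f6≈L+T^s s (t * e) ⟩
      L (t * e) + T (t * e) ^ s
        ≈⟨ +-cong (trans (L-scale e 𝔽q-t) (trans (*-congˡ L-e≈0) (zeroʳ t))) (^-congˡ s (trans (T-scale e 𝔽q-t) (trans (*-congˡ T-e≈1) (*-identityʳ t)))) ⟩
      0# + t ^ s               ≈⟨ +-identityˡ _ ⟩
      t ^ s                    ∎
    f6[ζ*e]≈f6[1*e] : f6 F q s a (ζ * e) ≈ f6 F q s a (1# * e)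
    f6[ζ*e]≈f6[1*e] = trans (f6[t*e]≈t^s 𝔽q-ζ) (trans ζ^s≈1 (sym (trans (f6[t*e]≈t^s 𝔽q-1) (1^n≈1 s))))

-- The statement uses unqualified ℕ arithmetic, which would clash with the ring operations opened above.
open import Data.Nat using (_+_; _*_; _^_; _∸_; _≤_; _<_)

theorem3p6 : ∀ {c ℓ} (p m s : ℕ) → Prime p → 1 ≤ m → 1 < s
    → (F : CommutativeRing c ℓ) → IsFiniteField F (p ^ (3 * m))
    → (a : CommutativeRing.Carrier F)
    → CommutativeRing._≈_ F (pow F a ((p ^ m) * (p ^ m) + (p ^ m) + 1)) (CommutativeRing.1# F)
    → IsPermutation F (f6 F (p ^ m) s a)
      ⇔ ((¬ CommutativeRing._≈_ F a (CommutativeRing.1# F)) × gcd s ((p ^ m) ∸ 1) ≡ 1)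
theorem3p6 p m s p-prime 1≤m 1<s F F-finite a a-norm = mk⇔ necessary sufficient
  where
  open CommutativeRing F using (_≈_; _≉_; 1#)
  open CubicExtension F p-prime 1≤m F-finite using (q; injective⇒surjective)
  open F6 F p-prime 1≤m F-finite a a-norm

  necessary : IsPermutation F (f6 F q s a) → a ≉ 1# × gcd s (q ∸ 1) ≡ 1
  necessary (f-injective , _) = a≉1 , decidable-stable (gcd s (q ∸ 1) ℕ.≟ 1) gcd≢1⇒⊥
    where
    a≉1 : a ≉ 1#
    a≉1 a≈1 = a≈1⇒f6-not-injective a≈1 s f-injective
    gcd≢1⇒⊥ : gcd s (q ∸ 1) ≢ 1 → ⊥
    gcd≢1⇒⊥ gcd≢1 = gcd≢1⇒f6-not-injective a≉1 s gcd≢1 f-injective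

  sufficient : a ≉ 1# × gcd s (q ∸ 1) ≡ 1 → IsPermutation F (f6 F q s a)
  sufficient (a≉1 , gcd≡1) = f-injective , injective⇒surjective (f6-cong s) f-injective
    where
    f-injective = f6-injective a≉1 s (ℕP.<⇒≤ 1<s) gcd≡1
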